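{- Let $t\ge1$, let $p_1,\dots,p_t\in\mathbb{F}_2[x]$ be pairwise coprime polynomials with $\deg(p_i)=d_i$, and for each $i$ let $S_i\subseteq\mathbb{F}_2[x]$ be a union of exactly $k_i\ge 1$ residue classes modulo $p_i$. Let $n$ be a positive integer, let $N$ be the number of polynomials in $\mathbb{F}_2[x]$ of degree at most $n-1$ that lie in none of $S_1,\dots,S_t$, and let $s$ be any integer with $1\le s\le t$. Then \[N>1+2^n\Big(1-\sum_{i=1}^s\frac{k_i}{2^{d_i}}\Big)\prod_{i=s+1}^t\Big(1-\frac{k_i}{2^{d_i}}\Big)-\Big(1+\sum_{i=1}^s k_i\Big)\prod_{i=s+1}^t(1+k_i).\]
   Context: Convention: the zero polynomial is regarded as having degree $0$, so there are exactly $2^n$ polynomials of degree at most $n-1$ in $\mathbb{F}_2[x]$. -}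

module Defs where

open import Data.Bool using (Bool; true; false; _xor_; if_then_else_)
open import Data.List using (List; []; _∷_; length)
open import Data.List.Relation.Unary.All using (All)
open import Data.Nat using (ℕ; zero; suc; _∸_; _^_; _<ᵇ_)
open import Data.Nat.Properties using (m^n≢0)
open import Data.Fin using (Fin; toℕ)
import Data.Fin as Fin
open import Data.Integer using (+_)
open import Data.Rational using (ℚ; 0ℚ; 1ℚ; _+_; _*_; _-_; _/_)
open import Data.Product using (Σ; ∃; _×_)
open import Relation.Binary.PropositionalEquality using (_≡_)

-- Polynomials over F₂ as little-endian coefficient lists
-- (the list b₀ ∷ b₁ ∷ … represents b₀ + b₁ x + …; trailing
-- zero coefficients are allowed, so equality of polynomials is _≈_).

Poly : Set
Poly = List Bool

_⊕_ : Poly → Poly → Poly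
[]       ⊕ ys       = ys
(x ∷ xs) ⊕ []       = x ∷ xs
(x ∷ xs) ⊕ (y ∷ ys) = (x xor y) ∷ (xs ⊕ ys)

_⊗_ : Poly → Poly → Poly
[]       ⊗ ys = []
(x ∷ xs) ⊗ ys = (if x then ys else []) ⊕ (false ∷ (xs ⊗ ys))

IsZero : Poly → Set
IsZero f = All (_≡ false) f

_≈_ : Poly → Poly → Set
f ≈ g = IsZero (f ⊕ g)

_∣_ : Poly → Poly → Set
g ∣ f = ∃ λ q → f ≈ (q ⊗ g)

Congruent : Poly → Poly → Poly → Set
Congruent p f g = p ∣ (f ⊕ g)

-- coprime: every common divisor is a unit (the only unit of F₂[x] is 1)
Coprime : Poly → Poly → Set
Coprime a b = ∀ g → g ∣ a → g ∣ b → g ≈ (true ∷ [])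

norm : Poly → Poly
norm [] = []
norm (true ∷ xs) = true ∷ norm xs
norm (false ∷ xs) with norm xs
... | []     = []
... | y ∷ ys = false ∷ y ∷ ys

-- degree; the zero polynomial has degree 0 (convention of the paper)
deg : Poly → ℕ
deg f = length (norm f) ∸ 1

_/2^_ : ℕ → ℕ → ℚ
k /2^ d = _/_ (+ k) (2 ^ d) {{m^n≢0 2 d}}

ℕ→ℚ : ℕ → ℚ
ℕ→ℚ m = (+ m) / 1

∑ : ∀ t → (Fin t → ℚ) → ℚ
∑ zero    f = 0ℚ
∑ (suc t) f = f Fin.zero + ∑ t (λ i → f (Fin.suc i))

∏ : ∀ t → (Fin t → ℚ) → ℚ
∏ zero    f = 1ℚ
∏ (suc t) f = f Fin.zero * ∏ t (λ i → f (Fin.suc i))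

-- with 0-based indices i : Fin t, paper index i+1:
-- ∑ᵢ₌₁ˢ f i   =  sum over toℕ i < s
∑≤ : ∀ t → ℕ → (Fin t → ℚ) → ℚ
∑≤ t s f = ∑ t (λ i → if toℕ i <ᵇ s then f i else 0ℚ)

-- ∏ᵢ₌ₛ₊₁ᵗ f i  =  product over toℕ i ≥ s
∏> : ∀ t → ℕ → (Fin t → ℚ) → ℚ
∏> t s f = ∏ t (λ i → if toℕ i <ᵇ s then 1ℚ else f i)

module Submission where

-- Polynomials of degree < n are their coefficient vectors in F₂ⁿ, and the remainder modulo a monic p
-- of degree D is a linear map F₂ⁿ → F₂ᴰ which is onto when D ≤ n; so every residue class modulo p
-- contains exactly 2^(n-D) of them, and at most one when n < D.  Removing S_i from a residue class
-- modulo v removes k_i residue classes modulo v p_i (Chinese remainder theorem), so by induction on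
-- the sets S_{s+1}, …, S_t the number of polynomials of a class modulo v avoiding them differs from
-- 2^n/2^(deg v) · ∏ (1 - k_i/2^(d_i)) by less than ∏ (1 + k_i); for v = 1 the base case is exact and
-- the lower bound improves by 1.  The sets S_1, …, S_s are then removed by a union bound, each meeting
-- those survivors in fewer than k_i (2^(n-d_i) ∏ (1 - k_j/2^(d_j)) + ∏ (1 + k_j)) points.

open import Algebra.Bundles using (CommutativeRing)
open import Algebra.Solver.Ring.AlmostCommutativeRing using (fromCommutativeRing)
import Algebra.Solver.Ring.Simple as RingSolver
open import Data.Bool using (Bool; true; false; _xor_; _∧_; _∨_; not; if_then_else_; T)
import Data.Bool.Properties as 𝔹
open import Data.Bool.Solver using (module xor-∧-Solver; module ∨-∧-Solver)
open import Data.Empty using (⊥; ⊥-elim)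
open import Data.Fin as Fin using (Fin)
import Data.Fin.Properties as Finₚ
import Data.Integer as ℤ
import Data.Integer.Properties as ℤₚ
import Data.Integer.Solver
open import Data.List using (List; []; _∷_; length; _++_)
import Data.List as List
open import Data.List.Membership.Propositional using (_∈_)
open import Data.List.Membership.Propositional.Properties using (∈-map⁺; ∈-map⁻; ∈-++⁺ˡ; ∈-++⁺ʳ)
import Data.List.Properties as Listₚ
open import Data.List.Relation.Unary.All using (All; []; _∷_; all?)
import Data.List.Relation.Unary.All as All
open import Data.List.Relation.Unary.AllPairs using ([]; _∷_)
open import Data.List.Relation.Unary.Any using (here; there)
open import Data.List.Relation.Unary.Unique.Propositional using (Unique)
import Data.List.Relation.Unary.Unique.Propositional.Properties as Uniqueₚ
import Data.Nat as ℕ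
open import Data.Nat using (ℕ; zero; suc; _+_; _∸_; _^_; _≤_; _<_; z≤n; s≤s)
open import Data.Nat.Induction using (<-rec)
import Data.Nat.Properties as ℕₚ
open import Data.Product using (Σ; ∃; ∃₂; _×_; _,_; proj₁; proj₂)
open import Data.Product.Function.NonDependent.Propositional using (_×-⇔_)
open import Data.Rational as ℚ using (ℚ; 0ℚ; 1ℚ)
import Data.Rational.Properties as ℚₚ
import Data.Rational.Solver
open import Data.Rational.Unnormalised as ℚᵘ using (mkℚᵘ; *≡*) renaming (_≃_ to _≃ᵘ_)
import Data.Rational.Unnormalised.Properties as ℚᵘₚ
open import Data.Sum using (_⊎_; inj₁; inj₂)
open import Data.Vec as Vec using (Vec; []; _∷_; toList; _∷ʳ_)
import Data.Vec.Properties as Vecₚ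
open import Function using (id; case_of_)
open import Function.Bundles using (_⇔_; mk⇔; Equivalence)
open import Function.Construct.Composition using (_⇔-∘_)
open import Function.Construct.Symmetry using (⇔-sym)
open import Relation.Binary.Bundles using (Setoid)
open import Relation.Binary.Definitions using (DecidableEquality)
open import Relation.Binary.PropositionalEquality
open import Relation.Nullary using (Dec; yes; no; ¬_; _×-dec_)
open import Relation.Nullary.Decidable using (decidable-stable; ⌊_⌋; toWitness; fromWitness; toWitnessFalse; isYes≗does; does-⇔)

open import Defs

module ℤ-Solver = Data.Integer.Solver.+-*-Solver
module ℚ-Solver = Data.Rational.Solver.+-*-Solver

-- Polynomials over F₂ up to trailing zeros

coeff : Poly → ℕ → Bool
coeff []      i       = false
coeff (b ∷ f) zero    = b
coeff (b ∷ f) (suc i) = coeff f i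

infix 4 _≈ᶜ_
record _≈ᶜ_ (f g : Poly) : Set where
  constructor coeffwise
  field coeff-≡ : ∀ i → coeff f i ≡ coeff g i
open _≈ᶜ_ public

≈ᶜ-refl : ∀ {f} → f ≈ᶜ f
≈ᶜ-refl = coeffwise λ _ → refl

≈ᶜ-sym : ∀ {f g} → f ≈ᶜ g → g ≈ᶜ f
≈ᶜ-sym e = coeffwise λ i → sym (coeff-≡ e i)

≈ᶜ-trans : ∀ {f g h} → f ≈ᶜ g → g ≈ᶜ h → f ≈ᶜ h
≈ᶜ-trans e e′ = coeffwise λ i → trans (coeff-≡ e i) (coeff-≡ e′ i)

≡⇒≈ᶜ : ∀ {f g} → f ≡ g → f ≈ᶜ g
≡⇒≈ᶜ refl = ≈ᶜ-refl

≈ᶜ-setoid : Setoid _ _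
≈ᶜ-setoid = record
  { Carrier = Poly ; _≈_ = _≈ᶜ_
  ; isEquivalence = record { refl = ≈ᶜ-refl ; sym = ≈ᶜ-sym ; trans = ≈ᶜ-trans } }

∷-cong : ∀ {b c f g} → b ≡ c → f ≈ᶜ g → b ∷ f ≈ᶜ c ∷ g
∷-cong b≡c e = coeffwise λ { zero → b≡c ; (suc i) → coeff-≡ e i }

coeff-⊕ : ∀ f g i → coeff (f ⊕ g) i ≡ coeff f i xor coeff g i
coeff-⊕ []      g       i       = refl
coeff-⊕ (x ∷ f) []      i       = sym (𝔹.xor-identityʳ _)
coeff-⊕ (x ∷ f) (y ∷ g) zero    = refl
coeff-⊕ (x ∷ f) (y ∷ g) (suc i) = coeff-⊕ f g i

IsZero⇒coeff≡false : ∀ {f} → IsZero f → ∀ i → coeff f i ≡ false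
IsZero⇒coeff≡false []       i       = refl
IsZero⇒coeff≡false (b ∷ bs) zero    = b
IsZero⇒coeff≡false (b ∷ bs) (suc i) = IsZero⇒coeff≡false bs i

coeff≡false⇒IsZero : ∀ f → (∀ i → coeff f i ≡ false) → IsZero f
coeff≡false⇒IsZero []      z = []
coeff≡false⇒IsZero (b ∷ f) z = z zero ∷ coeff≡false⇒IsZero f (λ i → z (suc i))

xor≡false⇒≡ : ∀ a b → a xor b ≡ false → a ≡ b
xor≡false⇒≡ true  true  _ = refl
xor≡false⇒≡ false false _ = refl

≈⇒≈ᶜ : ∀ {f g} → f ≈ g → f ≈ᶜ g
≈⇒≈ᶜ {f} {g} z = coeffwise λ i →
  xor≡false⇒≡ _ _ (trans (sym (coeff-⊕ f g i)) (IsZero⇒coeff≡false z i))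

≈ᶜ⇒≈ : ∀ {f g} → f ≈ᶜ g → f ≈ g
≈ᶜ⇒≈ {f} {g} e = coeff≡false⇒IsZero (f ⊕ g) λ i → begin
  coeff (f ⊕ g) i          ≡⟨ coeff-⊕ f g i ⟩
  coeff f i xor coeff g i  ≡⟨ cong (_xor coeff g i) (coeff-≡ e i) ⟩
  coeff g i xor coeff g i  ≡⟨ 𝔹.xor-same (coeff g i) ⟩
  false                    ∎
  where open ≡-Reasoning

≈ᶜ-dec : ∀ f g → Dec (f ≈ᶜ g)
≈ᶜ-dec f g with all? (𝔹._≟ false) (f ⊕ g)
... | yes z = yes (≈⇒≈ᶜ z)
... | no ¬z = no λ e → ¬z (≈ᶜ⇒≈ e)

⊕-cong : ∀ {a b c d} → a ≈ᶜ b → c ≈ᶜ d → a ⊕ c ≈ᶜ b ⊕ d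
⊕-cong {a} {b} {c} {d} e e′ = coeffwise λ i →
  trans (coeff-⊕ a c i) (trans (cong₂ _xor_ (coeff-≡ e i) (coeff-≡ e′ i)) (sym (coeff-⊕ b d i)))

⊕-identityʳ : ∀ f → f ⊕ [] ≈ᶜ f
⊕-identityʳ f = coeffwise λ i → trans (coeff-⊕ f [] i) (𝔹.xor-identityʳ _)

⊕-comm : ∀ f g → f ⊕ g ≈ᶜ g ⊕ f
⊕-comm f g = coeffwise λ i →
  trans (coeff-⊕ f g i) (trans (𝔹.xor-comm (coeff f i) (coeff g i)) (sym (coeff-⊕ g f i)))

⊕-assoc : ∀ f g h → (f ⊕ g) ⊕ h ≈ᶜ f ⊕ (g ⊕ h)
⊕-assoc f g h = coeffwise λ i → begin
  coeff ((f ⊕ g) ⊕ h) i                      ≡⟨ trans (coeff-⊕ (f ⊕ g) h i) (cong (_xor coeff h i) (coeff-⊕ f g i)) ⟩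
  (coeff f i xor coeff g i) xor coeff h i    ≡⟨ 𝔹.xor-assoc (coeff f i) (coeff g i) (coeff h i) ⟩
  coeff f i xor (coeff g i xor coeff h i)    ≡⟨ sym (trans (coeff-⊕ f (g ⊕ h) i) (cong (coeff f i xor_) (coeff-⊕ g h i))) ⟩
  coeff (f ⊕ (g ⊕ h)) i                      ∎
  where open ≡-Reasoning

⊕-self : ∀ f → f ⊕ f ≈ᶜ []
⊕-self f = coeffwise λ i → trans (coeff-⊕ f f i) (𝔹.xor-same (coeff f i))

coeff-scale : ∀ x b i → coeff (if x then b else []) i ≡ x ∧ coeff b i
coeff-scale true  b i = refl
coeff-scale false b i = refl

coeff-⊗-zero : ∀ x a b → coeff ((x ∷ a) ⊗ b) zero ≡ x ∧ coeff b zero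
coeff-⊗-zero x a b = trans (coeff-⊕ (if x then b else []) _ zero)
  (trans (𝔹.xor-identityʳ _) (coeff-scale x b zero))

coeff-⊗-suc : ∀ x a b i → coeff ((x ∷ a) ⊗ b) (suc i) ≡ (x ∧ coeff b (suc i)) xor coeff (a ⊗ b) i
coeff-⊗-suc x a b i = trans (coeff-⊕ (if x then b else []) _ (suc i))
  (cong (_xor coeff (a ⊗ b) i) (coeff-scale x b (suc i)))

coeff-⊗-distribʳ : ∀ a b c i → coeff ((a ⊕ b) ⊗ c) i ≡ coeff (a ⊗ c) i xor coeff (b ⊗ c) i
coeff-⊗-distribʳ []      b       c i       = refl
coeff-⊗-distribʳ (x ∷ a) []      c i       = sym (𝔹.xor-identityʳ _)
coeff-⊗-distribʳ (x ∷ a) (y ∷ b) c zero    = begin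
  coeff (((x xor y) ∷ (a ⊕ b)) ⊗ c) zero            ≡⟨ coeff-⊗-zero (x xor y) (a ⊕ b) c ⟩
  (x xor y) ∧ coeff c zero                          ≡⟨ 𝔹.∧-distribʳ-xor (coeff c zero) x y ⟩
  (x ∧ coeff c zero) xor (y ∧ coeff c zero)         ≡⟨ sym (cong₂ _xor_ (coeff-⊗-zero x a c) (coeff-⊗-zero y b c)) ⟩
  coeff ((x ∷ a) ⊗ c) zero xor coeff ((y ∷ b) ⊗ c) zero ∎
  where open ≡-Reasoning
coeff-⊗-distribʳ (x ∷ a) (y ∷ b) c (suc i) = begin
  coeff (((x xor y) ∷ (a ⊕ b)) ⊗ c) (suc i)          ≡⟨ coeff-⊗-suc (x xor y) (a ⊕ b) c i ⟩
  ((x xor y) ∧ C) xor coeff ((a ⊕ b) ⊗ c) i          ≡⟨ cong (((x xor y) ∧ C) xor_) (coeff-⊗-distribʳ a b c i) ⟩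
  ((x xor y) ∧ C) xor (coeff (a ⊗ c) i xor coeff (b ⊗ c) i)
    ≡⟨ solve 5 (λ x y C P Q → ((x :+ y) :* C) :+ (P :+ Q) := ((x :* C) :+ P) :+ ((y :* C) :+ Q)) refl
         x y C (coeff (a ⊗ c) i) (coeff (b ⊗ c) i) ⟩
  ((x ∧ C) xor coeff (a ⊗ c) i) xor ((y ∧ C) xor coeff (b ⊗ c) i)
    ≡⟨ sym (cong₂ _xor_ (coeff-⊗-suc x a c i) (coeff-⊗-suc y b c i)) ⟩
  coeff ((x ∷ a) ⊗ c) (suc i) xor coeff ((y ∷ b) ⊗ c) (suc i) ∎
  where
  open ≡-Reasoning
  open xor-∧-Solver
  C = coeff c (suc i)

coeff-⊗-distribˡ : ∀ a b c i → coeff (a ⊗ (b ⊕ c)) i ≡ coeff (a ⊗ b) i xor coeff (a ⊗ c) i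
coeff-⊗-distribˡ []      b c i       = refl
coeff-⊗-distribˡ (x ∷ a) b c zero    = begin
  coeff ((x ∷ a) ⊗ (b ⊕ c)) zero                     ≡⟨ coeff-⊗-zero x a (b ⊕ c) ⟩
  x ∧ coeff (b ⊕ c) zero                             ≡⟨ cong (x ∧_) (coeff-⊕ b c zero) ⟩
  x ∧ (coeff b zero xor coeff c zero)                ≡⟨ 𝔹.∧-distribˡ-xor x _ _ ⟩
  (x ∧ coeff b zero) xor (x ∧ coeff c zero)          ≡⟨ sym (cong₂ _xor_ (coeff-⊗-zero x a b) (coeff-⊗-zero x a c)) ⟩
  coeff ((x ∷ a) ⊗ b) zero xor coeff ((x ∷ a) ⊗ c) zero ∎
  where open ≡-Reasoning
coeff-⊗-distribˡ (x ∷ a) b c (suc i) = begin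
  coeff ((x ∷ a) ⊗ (b ⊕ c)) (suc i)                  ≡⟨ coeff-⊗-suc x a (b ⊕ c) i ⟩
  (x ∧ coeff (b ⊕ c) (suc i)) xor coeff (a ⊗ (b ⊕ c)) i
    ≡⟨ cong₂ (λ u v → (x ∧ u) xor v) (coeff-⊕ b c (suc i)) (coeff-⊗-distribˡ a b c i) ⟩
  (x ∧ (B xor C)) xor (coeff (a ⊗ b) i xor coeff (a ⊗ c) i)
    ≡⟨ solve 5 (λ x B C P Q → (x :* (B :+ C)) :+ (P :+ Q) := ((x :* B) :+ P) :+ ((x :* C) :+ Q)) refl
         x B C (coeff (a ⊗ b) i) (coeff (a ⊗ c) i) ⟩
  ((x ∧ B) xor coeff (a ⊗ b) i) xor ((x ∧ C) xor coeff (a ⊗ c) i)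
    ≡⟨ sym (cong₂ _xor_ (coeff-⊗-suc x a b i) (coeff-⊗-suc x a c i)) ⟩
  coeff ((x ∷ a) ⊗ b) (suc i) xor coeff ((x ∷ a) ⊗ c) (suc i) ∎
  where
  open ≡-Reasoning
  open xor-∧-Solver
  B = coeff b (suc i)
  C = coeff c (suc i)

⊗-distribʳ : ∀ a b c → (a ⊕ b) ⊗ c ≈ᶜ (a ⊗ c) ⊕ (b ⊗ c)
⊗-distribʳ a b c = coeffwise λ i →
  trans (coeff-⊗-distribʳ a b c i) (sym (coeff-⊕ (a ⊗ c) (b ⊗ c) i))

⊗-distribˡ : ∀ a b c → a ⊗ (b ⊕ c) ≈ᶜ (a ⊗ b) ⊕ (a ⊗ c)
⊗-distribˡ a b c = coeffwise λ i →
  trans (coeff-⊗-distribˡ a b c i) (sym (coeff-⊕ (a ⊗ b) (a ⊗ c) i))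

⊗-zeroʳ : ∀ a {z} → z ≈ᶜ [] → a ⊗ z ≈ᶜ []
⊗-zeroʳ []      z≈0 = ≈ᶜ-refl
⊗-zeroʳ (x ∷ a) {z} z≈0 = coeffwise λ
  { zero    → trans (coeff-⊗-zero x a z) (trans (cong (x ∧_) (coeff-≡ z≈0 zero)) (𝔹.∧-zeroʳ x))
  ; (suc i) → trans (coeff-⊗-suc x a z i)
                (cong₂ _xor_ (trans (cong (x ∧_) (coeff-≡ z≈0 (suc i))) (𝔹.∧-zeroʳ x))
                             (coeff-≡ (⊗-zeroʳ a z≈0) i)) }

⊗-congʳ : ∀ a {b c} → b ≈ᶜ c → a ⊗ b ≈ᶜ a ⊗ c
⊗-congʳ a {b} {c} b≈c = coeffwise λ i → xor≡false⇒≡ _ _ (begin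
  coeff (a ⊗ b) i xor coeff (a ⊗ c) i  ≡⟨ sym (coeff-⊗-distribˡ a b c i) ⟩
  coeff (a ⊗ (b ⊕ c)) i                ≡⟨ coeff-≡ (⊗-zeroʳ a (≈ᶜ-trans (⊕-cong b≈c ≈ᶜ-refl) (⊕-self c))) i ⟩
  false                                ∎)
  where open ≡-Reasoning

1ₚ : Poly
1ₚ = true ∷ []

⊗-identityʳ : ∀ a → a ⊗ 1ₚ ≈ᶜ a
⊗-identityʳ []      = ≈ᶜ-refl
⊗-identityʳ (x ∷ a) = coeffwise λ
  { zero    → trans (coeff-⊗-zero x a 1ₚ) (𝔹.∧-identityʳ x)
  ; (suc i) → trans (coeff-⊗-suc x a 1ₚ i)
                (cong₂ _xor_ (𝔹.∧-zeroʳ x) (coeff-≡ (⊗-identityʳ a) i)) }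

⊗-shiftʳ : ∀ a c → a ⊗ (false ∷ c) ≈ᶜ false ∷ (a ⊗ c)
⊗-shiftʳ []      c = coeffwise λ { zero → refl ; (suc i) → refl }
⊗-shiftʳ (x ∷ a) c = coeffwise λ
  { zero    → trans (coeff-⊗-zero x a (false ∷ c)) (𝔹.∧-zeroʳ x)
  ; (suc i) → trans (coeff-⊗-suc x a (false ∷ c) i)
                (trans (cong ((x ∧ coeff c i) xor_) (coeff-≡ (⊗-shiftʳ a c) i)) (shifted i)) }
  where
  shifted : ∀ i → (x ∧ coeff c i) xor coeff (false ∷ (a ⊗ c)) i ≡ coeff ((x ∷ a) ⊗ c) i
  shifted zero    = trans (𝔹.xor-identityʳ _) (sym (coeff-⊗-zero x a c))
  shifted (suc j) = sym (coeff-⊗-suc x a c j)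

⊗-comm : ∀ a b → a ⊗ b ≈ᶜ b ⊗ a
⊗-comm []      b = ≈ᶜ-sym (⊗-zeroʳ b ≈ᶜ-refl)
⊗-comm (x ∷ a) b = begin
  x·b ⊕ (false ∷ (a ⊗ b))        ≈⟨ ⊕-cong (≈ᶜ-sym (scaleʳ x)) (∷-cong refl (⊗-comm a b)) ⟩
  (b ⊗ x·1) ⊕ (false ∷ (b ⊗ a))  ≈⟨ ⊕-cong ≈ᶜ-refl (≈ᶜ-sym (⊗-shiftʳ b a)) ⟩
  (b ⊗ x·1) ⊕ (b ⊗ (false ∷ a))  ≈⟨ ≈ᶜ-sym (⊗-distribˡ b x·1 (false ∷ a)) ⟩
  b ⊗ (x·1 ⊕ (false ∷ a))        ≈⟨ ⊗-congʳ b (split x) ⟩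
  b ⊗ (x ∷ a)                    ∎
  where
  open import Relation.Binary.Reasoning.Setoid ≈ᶜ-setoid
  x·b = if x then b else []
  x·1 = if x then 1ₚ else []
  scaleʳ : ∀ x → b ⊗ (if x then 1ₚ else []) ≈ᶜ (if x then b else [])
  scaleʳ true  = ⊗-identityʳ b
  scaleʳ false = ⊗-zeroʳ b ≈ᶜ-refl
  split : ∀ x → (if x then 1ₚ else []) ⊕ (false ∷ a) ≈ᶜ x ∷ a
  split true  = coeffwise λ { zero → refl ; (suc i) → refl }
  split false = ≈ᶜ-refl

⊗-congˡ : ∀ {a b} c → a ≈ᶜ b → a ⊗ c ≈ᶜ b ⊗ c
⊗-congˡ {a} {b} c a≈b = ≈ᶜ-trans (⊗-comm a c) (≈ᶜ-trans (⊗-congʳ c a≈b) (⊗-comm c b))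

⊗-cong : ∀ {a b c d} → a ≈ᶜ b → c ≈ᶜ d → a ⊗ c ≈ᶜ b ⊗ d
⊗-cong {b = b} {c} a≈b c≈d = ≈ᶜ-trans (⊗-congˡ c a≈b) (⊗-congʳ b c≈d)

⊗-assoc : ∀ a b c → (a ⊗ b) ⊗ c ≈ᶜ a ⊗ (b ⊗ c)
⊗-assoc []      b c = ≈ᶜ-refl
⊗-assoc (x ∷ a) b c = begin
  ((if x then b else []) ⊕ (false ∷ (a ⊗ b))) ⊗ c     ≈⟨ ⊗-distribʳ (if x then b else []) (false ∷ (a ⊗ b)) c ⟩
  ((if x then b else []) ⊗ c) ⊕ (false ∷ ((a ⊗ b) ⊗ c)) ≈⟨ ⊕-cong (scale-⊗ x) (∷-cong refl (⊗-assoc a b c)) ⟩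
  (if x then b ⊗ c else []) ⊕ (false ∷ (a ⊗ (b ⊗ c)))  ∎
  where
  open import Relation.Binary.Reasoning.Setoid ≈ᶜ-setoid
  scale-⊗ : ∀ x → (if x then b else []) ⊗ c ≈ᶜ (if x then b ⊗ c else [])
  scale-⊗ true  = ≈ᶜ-refl
  scale-⊗ false = ≈ᶜ-refl

⊗-identityˡ : ∀ a → 1ₚ ⊗ a ≈ᶜ a
⊗-identityˡ a = ≈ᶜ-trans (⊗-comm 1ₚ a) (⊗-identityʳ a)

F₂[x] : CommutativeRing _ _
F₂[x] = record
  { Carrier = Poly ; _≈_ = _≈ᶜ_ ; _+_ = _⊕_ ; _*_ = _⊗_ ; -_ = id ; 0# = [] ; 1# = 1ₚ
  ; isCommutativeRing = record
    { isRing = record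
      { +-isAbelianGroup = record
        { isGroup = record
          { isMonoid = record
            { isSemigroup = record
              { isMagma = record { isEquivalence = Setoid.isEquivalence ≈ᶜ-setoid ; ∙-cong = ⊕-cong }
              ; assoc = ⊕-assoc }
            ; identity = (λ _ → ≈ᶜ-refl) , ⊕-identityʳ }
          ; inverse = ⊕-self , ⊕-self
          ; ⁻¹-cong = id }
        ; comm = ⊕-comm }
      ; *-cong = ⊗-cong
      ; *-assoc = ⊗-assoc
      ; *-identity = ⊗-identityˡ , ⊗-identityʳ
      ; distrib = ⊗-distribˡ , λ x y z → ⊗-distribʳ y z x }
    ; *-comm = ⊗-comm } }

module F₂[x]-Solver = RingSolver (fromCommutativeRing F₂[x]) ≈ᶜ-dec

infix 4 _∣ᶜ_
_∣ᶜ_ : Poly → Poly → Set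
m ∣ᶜ g = ∃ λ q → g ≈ᶜ q ⊗ m

∣ᶜ-respʳ : ∀ {m g g′} → g ≈ᶜ g′ → m ∣ᶜ g → m ∣ᶜ g′
∣ᶜ-respʳ g≈g′ (q , g≈qm) = q , ≈ᶜ-trans (≈ᶜ-sym g≈g′) g≈qm

∣ᶜ-respˡ : ∀ {m m′ g} → m ≈ᶜ m′ → m ∣ᶜ g → m′ ∣ᶜ g
∣ᶜ-respˡ m≈m′ (q , g≈qm) = q , ≈ᶜ-trans g≈qm (⊗-congʳ q m≈m′)

∣ᶜ-⊕ : ∀ {m a b} → m ∣ᶜ a → m ∣ᶜ b → m ∣ᶜ a ⊕ b
∣ᶜ-⊕ {m} (q , a≈) (q′ , b≈) = q ⊕ q′ , ≈ᶜ-trans (⊕-cong a≈ b≈) (≈ᶜ-sym (⊗-distribʳ q q′ m))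

∣ᶜ-trans : ∀ {a b g} → a ∣ᶜ b → b ∣ᶜ g → a ∣ᶜ g
∣ᶜ-trans {a} (q , b≈) (q′ , g≈) = q′ ⊗ q , ≈ᶜ-trans g≈ (≈ᶜ-trans (⊗-congʳ q′ b≈) (≈ᶜ-sym (⊗-assoc q′ q a)))

∣ᶜ-refl : ∀ m → m ∣ᶜ m
∣ᶜ-refl m = 1ₚ , ≈ᶜ-sym (⊗-identityˡ m)

∣ᶜ⇒∣ : ∀ {g m} → g ∣ᶜ m → g ∣ m
∣ᶜ⇒∣ (q , m≈qg) = q , ≈ᶜ⇒≈ m≈qg

∣⇒∣ᶜ : ∀ {g m} → g ∣ m → g ∣ᶜ m
∣⇒∣ᶜ (q , m≈qg) = q , ≈⇒≈ᶜ m≈qg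

-- Remainders modulo a monic polynomial

infix 4 _≟ᵛ_
_≟ᵛ_ : ∀ {D} (u v : Vec Bool D) → Dec (u ≡ v)
_≟ᵛ_ = Vecₚ.≡-dec 𝔹._≟_

_⊻_ : ∀ {D} → Vec Bool D → Vec Bool D → Vec Bool D
_⊻_ = Vec.zipWith _xor_

0ᵛ : ∀ D → Vec Bool D
0ᵛ D = Vec.replicate D false

_·ᵛ_ : ∀ {D} → Bool → Vec Bool D → Vec Bool D
b ·ᵛ w = Vec.map (b ∧_) w

⊻-identityˡ : ∀ {D} (v : Vec Bool D) → 0ᵛ D ⊻ v ≡ v
⊻-identityˡ = Vecₚ.zipWith-identityˡ 𝔹.xor-identityˡ

⊻-identityʳ : ∀ {D} (v : Vec Bool D) → v ⊻ 0ᵛ D ≡ v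
⊻-identityʳ = Vecₚ.zipWith-identityʳ 𝔹.xor-identityʳ

⊻-self : ∀ {D} (v : Vec Bool D) → v ⊻ v ≡ 0ᵛ D
⊻-self []      = refl
⊻-self (x ∷ v) = cong₂ _∷_ (𝔹.xor-same x) (⊻-self v)

⊻-medial : ∀ {D} (a b c d : Vec Bool D) → (a ⊻ b) ⊻ (c ⊻ d) ≡ (a ⊻ c) ⊻ (b ⊻ d)
⊻-medial []       []       []       []       = refl
⊻-medial (a ∷ as) (b ∷ bs) (c ∷ cs) (d ∷ ds) = cong₂ _∷_
  (solve 4 (λ a b c d → (a :+ b) :+ (c :+ d) := (a :+ c) :+ (b :+ d)) refl a b c d)
  (⊻-medial as bs cs ds)
  where open xor-∧-Solver

⊻-cancelʳ : ∀ {D} (a u : Vec Bool D) → (a ⊻ u) ⊻ u ≡ a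
⊻-cancelʳ a u = begin
  (a ⊻ u) ⊻ u  ≡⟨ Vecₚ.zipWith-assoc 𝔹.xor-assoc a u u ⟩
  a ⊻ (u ⊻ u)  ≡⟨ cong (a ⊻_) (⊻-self u) ⟩
  a ⊻ 0ᵛ _     ≡⟨ ⊻-identityʳ a ⟩
  a            ∎
  where open ≡-Reasoning

⊻≡0⇒≡ : ∀ {D} (u v : Vec Bool D) → u ⊻ v ≡ 0ᵛ D → u ≡ v
⊻≡0⇒≡ u v e = trans (sym (⊻-cancelʳ u v)) (trans (cong (_⊻ v) e) (⊻-identityˡ v))

·ᵛ-distrib-xor : ∀ {D} x y (w : Vec Bool D) → (x xor y) ·ᵛ w ≡ (x ·ᵛ w) ⊻ (y ·ᵛ w)
·ᵛ-distrib-xor x y []      = refl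
·ᵛ-distrib-xor x y (b ∷ w) = cong₂ _∷_ (𝔹.∧-distribʳ-xor b x y) (·ᵛ-distrib-xor x y w)

false·ᵛ : ∀ {D} (w : Vec Bool D) → false ·ᵛ w ≡ 0ᵛ D
false·ᵛ []      = refl
false·ᵛ (b ∷ w) = cong (false ∷_) (false·ᵛ w)

true·ᵛ : ∀ {D} (w : Vec Bool D) → true ·ᵛ w ≡ w
true·ᵛ = Vecₚ.map-id

toList-0ᵛ : ∀ D → toList (0ᵛ D) ≈ᶜ []
toList-0ᵛ zero    = ≈ᶜ-refl
toList-0ᵛ (suc D) = coeffwise λ { zero → refl ; (suc i) → coeff-≡ (toList-0ᵛ D) i }

toList-≈ᶜ-injective : ∀ {D} (u v : Vec Bool D) → toList u ≈ᶜ toList v → u ≡ v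
toList-≈ᶜ-injective []      []      e = refl
toList-≈ᶜ-injective (x ∷ u) (y ∷ v) e =
  cong₂ _∷_ (coeff-≡ e zero) (toList-≈ᶜ-injective u v (coeffwise λ i → coeff-≡ e (suc i)))

-- x^D + w(x)
monic : ∀ {D} → Vec Bool D → Poly
monic w = toList w ++ (true ∷ [])

-- The low D coefficients of b + x·r, and its coefficient of x^D.
shiftIn : ∀ {D} → Bool → Vec Bool D → Vec Bool D × Bool
shiftIn b []      = [] , b
shiftIn b (x ∷ r) = b ∷ proj₁ (shiftIn x r) , proj₂ (shiftIn x r)

-- Reduction of b + x·r modulo monic w, for r already reduced.
reduceStep : ∀ {D} → Vec Bool D → Bool → Vec Bool D → Vec Bool D
reduceStep w b r = proj₁ (shiftIn b r) ⊻ (proj₂ (shiftIn b r) ·ᵛ w)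

rem : ∀ {D} → Vec Bool D → Poly → Vec Bool D
rem {D} w []      = 0ᵛ D
rem     w (b ∷ f) = reduceStep w b (rem w f)

quot : ∀ {D} → Vec Bool D → Poly → Poly
quot w []      = []
quot w (b ∷ f) = proj₂ (shiftIn b (rem w f)) ∷ quot w f

toList-shiftIn : ∀ {D} b (r : Vec Bool D) →
  toList (proj₁ (shiftIn b r)) ++ (proj₂ (shiftIn b r) ∷ []) ≡ b ∷ toList r
toList-shiftIn b []      = refl
toList-shiftIn b (x ∷ r) = cong (b ∷_) (toList-shiftIn x r)

shiftIn-split : ∀ {D} b (r : Vec Bool D) xs c → b ∷ toList r ≡ xs ++ (c ∷ []) →
  toList (proj₁ (shiftIn b r)) ≡ xs × proj₂ (shiftIn b r) ≡ c
shiftIn-split b r xs c e = Listₚ.∷ʳ-injective _ xs (trans (toList-shiftIn b r) e)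

shiftIn-⊻ : ∀ {D} x y (r r′ : Vec Bool D) →
  shiftIn (x xor y) (r ⊻ r′) ≡ (proj₁ (shiftIn x r) ⊻ proj₁ (shiftIn y r′) , proj₂ (shiftIn x r) xor proj₂ (shiftIn y r′))
shiftIn-⊻ x y []      []        = refl
shiftIn-⊻ x y (a ∷ r) (b ∷ r′) rewrite shiftIn-⊻ a b r r′ = refl

reduceStep-⊻ : ∀ {D} (w : Vec Bool D) x y r r′ →
  reduceStep w (x xor y) (r ⊻ r′) ≡ reduceStep w x r ⊻ reduceStep w y r′
reduceStep-⊻ w x y r r′ rewrite shiftIn-⊻ x y r r′ = begin
  (s ⊻ s′) ⊻ ((t xor t′) ·ᵛ w)       ≡⟨ cong ((s ⊻ s′) ⊻_) (·ᵛ-distrib-xor t t′ w) ⟩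
  (s ⊻ s′) ⊻ ((t ·ᵛ w) ⊻ (t′ ·ᵛ w))  ≡⟨ ⊻-medial s s′ (t ·ᵛ w) (t′ ·ᵛ w) ⟩
  (s ⊻ (t ·ᵛ w)) ⊻ (s′ ⊻ (t′ ·ᵛ w))  ∎
  where
  open ≡-Reasoning
  s = proj₁ (shiftIn x r) ; t = proj₂ (shiftIn x r)
  s′ = proj₁ (shiftIn y r′) ; t′ = proj₂ (shiftIn y r′)

reduceStep-0 : ∀ {D} (w : Vec Bool D) → reduceStep w false (0ᵛ D) ≡ 0ᵛ D
reduceStep-0 {D} w = begin
  reduceStep w false (0ᵛ D)                              ≡⟨ cong (reduceStep w false) (sym (⊻-self (0ᵛ D))) ⟩
  reduceStep w (false xor false) (0ᵛ D ⊻ 0ᵛ D)           ≡⟨ reduceStep-⊻ w false false (0ᵛ D) (0ᵛ D) ⟩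
  reduceStep w false (0ᵛ D) ⊻ reduceStep w false (0ᵛ D)  ≡⟨ ⊻-self _ ⟩
  0ᵛ D                                                   ∎
  where open ≡-Reasoning

rem-⊕ : ∀ {D} (w : Vec Bool D) f g → rem w (f ⊕ g) ≡ rem w f ⊻ rem w g
rem-⊕ w []      g       = sym (⊻-identityˡ (rem w g))
rem-⊕ w (x ∷ f) []      = sym (⊻-identityʳ (rem w (x ∷ f)))
rem-⊕ w (x ∷ f) (y ∷ g) = trans (cong (reduceStep w (x xor y)) (rem-⊕ w f g)) (reduceStep-⊻ w x y (rem w f) (rem w g))

rem-≈ᶜ-0 : ∀ {D} (w : Vec Bool D) {f} → f ≈ᶜ [] → rem w f ≡ 0ᵛ D
rem-≈ᶜ-0 w {[]}    f≈0 = refl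
rem-≈ᶜ-0 w {x ∷ f} f≈0 rewrite coeff-≡ f≈0 zero =
  trans (cong (reduceStep w false) (rem-≈ᶜ-0 w {f} (coeffwise λ i → coeff-≡ f≈0 (suc i)))) (reduceStep-0 w)

rem-cong : ∀ {D} (w : Vec Bool D) {f g} → f ≈ᶜ g → rem w f ≡ rem w g
rem-cong w {f} {g} f≈g = ⊻≡0⇒≡ _ _ (trans (sym (rem-⊕ w f g))
  (rem-≈ᶜ-0 w (≈ᶜ-trans (⊕-cong f≈g ≈ᶜ-refl) (⊕-self g))))

snoc-false : ∀ (xs : Poly) → xs ++ (false ∷ []) ≈ᶜ xs
snoc-false []       = coeffwise λ { zero → refl ; (suc i) → refl }
snoc-false (x ∷ xs) = ∷-cong refl (snoc-false xs)

snoc-true : ∀ {D} (s w : Vec Bool D) → toList s ++ (true ∷ []) ≈ᶜ monic w ⊕ toList (s ⊻ w)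
snoc-true []      []      = ≈ᶜ-refl
snoc-true (a ∷ s) (b ∷ w) = ∷-cong (solve 2 (λ a b → a := b :+ (a :+ b)) refl a b) (snoc-true s w)
  where open xor-∧-Solver

snoc-reduce : ∀ {D} (w s : Vec Bool D) t →
  toList s ++ (t ∷ []) ≈ᶜ (if t then monic w else []) ⊕ toList (s ⊻ (t ·ᵛ w))
snoc-reduce {D} w s false = begin
  toList s ++ (false ∷ [])       ≈⟨ snoc-false (toList s) ⟩
  toList s                       ≡⟨ cong toList (sym (⊻-identityʳ s)) ⟩
  toList (s ⊻ 0ᵛ D)              ≡⟨ cong (λ v → toList (s ⊻ v)) (sym (false·ᵛ w)) ⟩
  toList (s ⊻ (false ·ᵛ w))      ∎
  where open import Relation.Binary.Reasoning.Setoid ≈ᶜ-setoid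
snoc-reduce w s true rewrite true·ᵛ w = snoc-true s w

division : ∀ {D} (w : Vec Bool D) f → f ≈ᶜ (quot w f ⊗ monic w) ⊕ toList (rem w f)
division {D} w []      = ≈ᶜ-sym (toList-0ᵛ D)
division     w (b ∷ f) = begin
  b ∷ f                                  ≈⟨ ∷-cong refl (division w f) ⟩
  b ∷ (QM ⊕ toList (rem w f))            ≈⟨ ∷-cong (sym (𝔹.xor-identityʳ b)) (⊕-comm QM (toList (rem w f))) ⟩
  (b ∷ toList (rem w f)) ⊕ X             ≡⟨ cong (_⊕ X) (sym (toList-shiftIn b (rem w f))) ⟩
  (toList s ++ (t ∷ [])) ⊕ X             ≈⟨ ⊕-cong (snoc-reduce w s t) ≈ᶜ-refl ⟩
  (t·M ⊕ r) ⊕ X                          ≈⟨ ⊕-assoc t·M r X ⟩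
  t·M ⊕ (r ⊕ X)                          ≈⟨ ⊕-cong (≈ᶜ-refl {t·M}) (⊕-comm r X) ⟩
  t·M ⊕ (X ⊕ r)                          ≈⟨ ≈ᶜ-sym (⊕-assoc t·M X r) ⟩
  (t·M ⊕ X) ⊕ r                          ∎
  where
  open import Relation.Binary.Reasoning.Setoid ≈ᶜ-setoid
  QM = quot w f ⊗ monic w
  X = false ∷ QM
  r = toList (reduceStep w b (rem w f))
  s = proj₁ (shiftIn b (rem w f))
  t = proj₂ (shiftIn b (rem w f))
  t·M = if t then monic w else []

toList-rem-short : ∀ {D} (w : Vec Bool D) h k → length h + k ≡ D →
  toList (rem w h) ≡ h ++ List.replicate k false
toList-rem-short {D} w []      k e = trans (Vecₚ.toList-replicate D false) (cong (λ m → List.replicate m false) (sym e))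
toList-rem-short     w (b ∷ h) k e = begin
  toList (s ⊻ (t ·ᵛ w))       ≡⟨ cong (λ c → toList (s ⊻ (c ·ᵛ w))) (proj₂ split) ⟩
  toList (s ⊻ (false ·ᵛ w))   ≡⟨ cong (λ v → toList (s ⊻ v)) (false·ᵛ w) ⟩
  toList (s ⊻ 0ᵛ _)           ≡⟨ cong toList (⊻-identityʳ s) ⟩
  toList s                    ≡⟨ proj₁ split ⟩
  b ∷ h ++ List.replicate k false ∎
  where
  open ≡-Reasoning
  s = proj₁ (shiftIn b (rem w h))
  t = proj₂ (shiftIn b (rem w h))
  replicate-∷ʳ : ∀ k → List.replicate (suc k) false ≡ List.replicate k false ++ (false ∷ [])
  replicate-∷ʳ zero    = refl
  replicate-∷ʳ (suc k) = cong (false ∷_) (replicate-∷ʳ k)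
  split : toList s ≡ b ∷ h ++ List.replicate k false × t ≡ false
  split = shiftIn-split b (rem w h) (b ∷ h ++ List.replicate k false) false (cong (b ∷_) (begin
    toList (rem w h)                                  ≡⟨ toList-rem-short w h (suc k) (trans (ℕₚ.+-suc (length h) k) e) ⟩
    h ++ List.replicate (suc k) false                 ≡⟨ cong (h ++_) (replicate-∷ʳ k) ⟩
    h ++ (List.replicate k false ++ (false ∷ []))     ≡⟨ sym (Listₚ.++-assoc h _ _) ⟩
    (h ++ List.replicate k false) ++ (false ∷ [])     ∎))

length-monic : ∀ {D} (w : Vec Bool D) → length (monic w) ≡ suc D
length-monic {D} w = trans (Listₚ.length-++ (toList w)) (trans (cong (_+ 1) (Vecₚ.length-toList w)) (ℕₚ.+-comm D 1))

rem-monic : ∀ {D} (w : Vec Bool D) → rem w (monic w) ≡ 0ᵛ D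
rem-monic []        = refl
rem-monic (w₀ ∷ w′) = begin
  s ⊻ (t ·ᵛ w)        ≡⟨ cong₂ (λ u c → u ⊻ (c ·ᵛ w)) (toList-≈ᶜ-injective s w (≡⇒≈ᶜ (proj₁ split))) (proj₂ split) ⟩
  w ⊻ (true ·ᵛ w)     ≡⟨ cong (w ⊻_) (true·ᵛ w) ⟩
  w ⊻ w               ≡⟨ ⊻-self w ⟩
  0ᵛ _                ∎
  where
  open ≡-Reasoning
  w = w₀ ∷ w′
  high = toList w′ ++ (true ∷ [])
  s = proj₁ (shiftIn w₀ (rem w high))
  t = proj₂ (shiftIn w₀ (rem w high))
  high-reduced : toList (rem w high) ≡ high
  high-reduced = trans (toList-rem-short w high 0 (trans (ℕₚ.+-identityʳ _) (length-monic w′)))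
                       (Listₚ.++-identityʳ high)
  split : toList s ≡ toList w × t ≡ true
  split = shiftIn-split w₀ (rem w high) (toList w) true (cong (w₀ ∷_) high-reduced)

rem-multiple : ∀ {D} (w : Vec Bool D) q → rem w (q ⊗ monic w) ≡ 0ᵛ D
rem-multiple     w []      = refl
rem-multiple {D} w (x ∷ q) = begin
  rem w ((if x then monic w else []) ⊕ (false ∷ (q ⊗ monic w)))
    ≡⟨ rem-⊕ w (if x then monic w else []) (false ∷ (q ⊗ monic w)) ⟩
  rem w (if x then monic w else []) ⊻ reduceStep w false (rem w (q ⊗ monic w))
    ≡⟨ cong₂ _⊻_ (rem-scaled x) (trans (cong (reduceStep w false) (rem-multiple w q)) (reduceStep-0 w)) ⟩
  0ᵛ D ⊻ 0ᵛ D
    ≡⟨ ⊻-self (0ᵛ D) ⟩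
  0ᵛ D ∎
  where
  open ≡-Reasoning
  rem-scaled : ∀ x → rem w (if x then monic w else []) ≡ 0ᵛ D
  rem-scaled true  = rem-monic w
  rem-scaled false = refl

rem≡0⇔∣ᶜ : ∀ {D} (w : Vec Bool D) g → rem w g ≡ 0ᵛ D ⇔ monic w ∣ᶜ g
rem≡0⇔∣ᶜ {D} w g = mk⇔ to from
  where
  to : rem w g ≡ 0ᵛ D → monic w ∣ᶜ g
  to r≡0 = quot w g , ≈ᶜ-trans (division w g)
    (≈ᶜ-trans (⊕-cong ≈ᶜ-refl (≈ᶜ-trans (≡⇒≈ᶜ (cong toList r≡0)) (toList-0ᵛ D))) (⊕-identityʳ _))
  from : monic w ∣ᶜ g → rem w g ≡ 0ᵛ D
  from (q , g≈qm) = trans (rem-cong w g≈qm) (rem-multiple w q)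

rem≡⇔∣ᶜ : ∀ {D} (w : Vec Bool D) f e → rem w f ≡ rem w e ⇔ monic w ∣ᶜ f ⊕ e
rem≡⇔∣ᶜ w f e = mk⇔
  (λ r≡ → Equivalence.to (rem≡0⇔∣ᶜ w (f ⊕ e)) (trans (rem-⊕ w f e) (trans (cong (_⊻ rem w e) r≡) (⊻-self (rem w e)))))
  (λ m∣ → ⊻≡0⇒≡ _ _ (trans (sym (rem-⊕ w f e)) (Equivalence.from (rem≡0⇔∣ᶜ w (f ⊕ e)) m∣)))

-- Bézout identities, the Chinese remainder theorem and Euclid's algorithm

Bezout : Poly → Poly → Set
Bezout a b = ∃₂ λ u v → (u ⊗ a) ⊕ (v ⊗ b) ≈ᶜ 1ₚ

Bezout-respˡ : ∀ {a a′ b} → a ≈ᶜ a′ → Bezout a b → Bezout a′ b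
Bezout-respˡ {b = b} a≈a′ (u , v , e) = u , v , ≈ᶜ-trans (⊕-cong (⊗-congʳ u (≈ᶜ-sym a≈a′)) (≈ᶜ-refl {v ⊗ b})) e

Bezout-⊗ˡ : ∀ {a b c} → Bezout a c → Bezout b c → Bezout (a ⊗ b) c
Bezout-⊗ˡ {a} {b} {c} (u , v , e) (u′ , v′ , e′) = u ⊗ u′ , v″ , (begin
  ((u ⊗ u′) ⊗ (a ⊗ b)) ⊕ (v″ ⊗ c)
    ≈⟨ solve 7 (λ u v u′ v′ a b c → ((u :* u′) :* (a :* b)) :+ ((((u :* a) :* v′) :+ ((v :* (u′ :* b)) :+ ((v :* v′) :* c))) :* c)
                                     := ((u :* a) :+ (v :* c)) :* ((u′ :* b) :+ (v′ :* c))) ≈ᶜ-refl u v u′ v′ a b c ⟩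
  ((u ⊗ a) ⊕ (v ⊗ c)) ⊗ ((u′ ⊗ b) ⊕ (v′ ⊗ c)) ≈⟨ ⊗-cong e e′ ⟩
  1ₚ ⊗ 1ₚ                                     ≈⟨ ⊗-identityˡ 1ₚ ⟩
  1ₚ                                          ∎)
  where
  open F₂[x]-Solver
  open import Relation.Binary.Reasoning.Setoid ≈ᶜ-setoid
  v″ = ((u ⊗ a) ⊗ v′) ⊕ ((v ⊗ (u′ ⊗ b)) ⊕ ((v ⊗ v′) ⊗ c))

∣ᶜ-⊗-coprime : ∀ {a b h} → Bezout a b → a ∣ᶜ h → b ∣ᶜ h → a ⊗ b ∣ᶜ h
∣ᶜ-⊗-coprime {a} {b} {h} (u , v , e) (q , h≈qa) (q′ , h≈q′b) = (u ⊗ q′) ⊕ (v ⊗ q) , (begin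
  h                                             ≈⟨ ≈ᶜ-sym (⊗-identityˡ h) ⟩
  1ₚ ⊗ h                                        ≈⟨ ⊗-congˡ h (≈ᶜ-sym e) ⟩
  ((u ⊗ a) ⊕ (v ⊗ b)) ⊗ h                       ≈⟨ ⊗-distribʳ (u ⊗ a) (v ⊗ b) h ⟩
  ((u ⊗ a) ⊗ h) ⊕ ((v ⊗ b) ⊗ h)                 ≈⟨ ⊕-cong (⊗-congʳ (u ⊗ a) h≈q′b) (⊗-congʳ (v ⊗ b) h≈qa) ⟩
  ((u ⊗ a) ⊗ (q′ ⊗ b)) ⊕ ((v ⊗ b) ⊗ (q ⊗ a))
    ≈⟨ solve 6 (λ u v q q′ a b → ((u :* a) :* (q′ :* b)) :+ ((v :* b) :* (q :* a)) := ((u :* q′) :+ (v :* q)) :* (a :* b))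
               ≈ᶜ-refl u v q q′ a b ⟩
  ((u ⊗ q′) ⊕ (v ⊗ q)) ⊗ (a ⊗ b)                ∎)
  where
  open F₂[x]-Solver
  open import Relation.Binary.Reasoning.Setoid ≈ᶜ-setoid

∣ᶜ-⊕-sym : ∀ {m} f g → m ∣ᶜ f ⊕ g → m ∣ᶜ g ⊕ f
∣ᶜ-⊕-sym f g = ∣ᶜ-respʳ (⊕-comm f g)

∣ᶜ-⊕-trans : ∀ {m} f g h → m ∣ᶜ f ⊕ g → m ∣ᶜ g ⊕ h → m ∣ᶜ f ⊕ h
∣ᶜ-⊕-trans f g h m∣fg m∣gh = ∣ᶜ-respʳ
  (solve 3 (λ f g h → (f :+ g) :+ (g :+ h) := f :+ h) ≈ᶜ-refl f g h) (∣ᶜ-⊕ m∣fg m∣gh)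
  where open F₂[x]-Solver

-- If u a + v b = 1, then e₁ + u a (e₁ + e₂) ≡ e₁ (mod a) and ≡ e₂ (mod b).
crt-solution : ∀ {a b} → Bezout a b → Poly → Poly → Poly
crt-solution {a} (u , _ , _) e₁ e₂ = e₁ ⊕ ((u ⊗ a) ⊗ (e₁ ⊕ e₂))

crt : ∀ {a b} (bz : Bezout a b) e₁ e₂ f → (a ∣ᶜ f ⊕ e₁ × b ∣ᶜ f ⊕ e₂) ⇔ a ⊗ b ∣ᶜ f ⊕ crt-solution bz e₁ e₂
crt {a} {b} bz@(u , v , ua+vb≈1) e₁ e₂ f = mk⇔
  (λ (a∣ , b∣) → ∣ᶜ-⊗-coprime bz (∣ᶜ-⊕-trans f e₁ e a∣ (∣ᶜ-⊕-sym e e₁ a∣e⊕e₁))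
                                 (∣ᶜ-⊕-trans f e₂ e b∣ (∣ᶜ-⊕-sym e e₂ b∣e⊕e₂)))
  (λ ab∣ → ∣ᶜ-⊕-trans f e e₁ (∣ᶜ-trans (b , ⊗-comm a b) ab∣) a∣e⊕e₁ ,
           ∣ᶜ-⊕-trans f e e₂ (∣ᶜ-trans (a , ≈ᶜ-refl) ab∣) b∣e⊕e₂)
  where
  open F₂[x]-Solver
  g e : Poly
  g = e₁ ⊕ e₂
  e = crt-solution bz e₁ e₂
  a∣e⊕e₁ : a ∣ᶜ e ⊕ e₁
  a∣e⊕e₁ = u ⊗ g , solve 4 (λ e₁ u a g → (e₁ :+ ((u :* a) :* g)) :+ e₁ := (u :* g) :* a) ≈ᶜ-refl e₁ u a g
  b∣e⊕e₂ : b ∣ᶜ e ⊕ e₂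
  b∣e⊕e₂ = v ⊗ g , (begin
    e ⊕ e₂                                   ≈⟨ solve 5 (λ e₁ e₂ u a v → (e₁ :+ ((u :* a) :* (e₁ :+ e₂))) :+ e₂
                                                             := ((u :* a) :+ con 1ₚ) :* (e₁ :+ e₂)) ≈ᶜ-refl e₁ e₂ u a v ⟩
    ((u ⊗ a) ⊕ 1ₚ) ⊗ g                       ≈⟨ ⊗-congˡ g (⊕-cong (≈ᶜ-refl {u ⊗ a}) (≈ᶜ-sym ua+vb≈1)) ⟩
    ((u ⊗ a) ⊕ ((u ⊗ a) ⊕ (v ⊗ b))) ⊗ g
      ≈⟨ solve 6 (λ u a v b e₁ e₂ → ((u :* a) :+ ((u :* a) :+ (v :* b))) :* (e₁ :+ e₂) := (v :* (e₁ :+ e₂)) :* b)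
           ≈ᶜ-refl u a v b e₁ e₂ ⟩
    (v ⊗ g) ⊗ b                              ∎)
    where open import Relation.Binary.Reasoning.Setoid ≈ᶜ-setoid

norm-≈ᶜ : ∀ h → norm h ≈ᶜ h
norm-≈ᶜ []           = ≈ᶜ-refl
norm-≈ᶜ (true ∷ xs)  = ∷-cong refl (norm-≈ᶜ xs)
norm-≈ᶜ (false ∷ xs) with norm xs | norm-≈ᶜ xs
... | []     | e = coeffwise λ { zero → refl ; (suc i) → coeff-≡ e i }
... | y ∷ ys | e = ∷-cong refl e

-- Over F₂ a nonzero normalised polynomial has leading coefficient 1.
norm≡[]⊎monic : ∀ h → norm h ≡ [] ⊎ ∃₂ λ E (w : Vec Bool E) → norm h ≡ monic w
norm≡[]⊎monic []          = inj₁ refl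
norm≡[]⊎monic (true ∷ xs) with norm≡[]⊎monic xs
... | inj₁ e             = inj₂ (0 , [] , cong (true ∷_) e)
... | inj₂ (E , w , e)   = inj₂ (suc E , true ∷ w , cong (true ∷_) e)
norm≡[]⊎monic (false ∷ xs) with norm xs | norm≡[]⊎monic xs
... | []     | _                = inj₁ refl
... | y ∷ ys | inj₂ (E , w , e) = inj₂ (suc E , false ∷ w , cong (false ∷_) e)

length-norm : ∀ h → length (norm h) ≤ length h
length-norm []           = z≤n
length-norm (true ∷ xs)  = s≤s (length-norm xs)
length-norm (false ∷ xs) with norm xs | length-norm xs
... | []     | _ = z≤n
... | y ∷ ys | l = s≤s l

nonzero⇒monic : ∀ {d} p → ¬ IsZero p → deg p ≡ d → Σ (Vec Bool d) λ w → p ≈ᶜ monic w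
nonzero⇒monic p p≢0 deg≡d with norm≡[]⊎monic p
... | inj₁ e = ⊥-elim (p≢0 (coeff≡false⇒IsZero p λ i →
                 trans (sym (coeff-≡ (norm-≈ᶜ p) i)) (cong (λ h → coeff h i) e)))
... | inj₂ (E , w , e) = subst (Vec Bool) E≡d w , (begin
  p                                   ≈⟨ ≈ᶜ-sym (norm-≈ᶜ p) ⟩
  norm p                              ≡⟨ e ⟩
  monic w                             ≡⟨ sym (monic-subst E≡d w) ⟩
  monic (subst (Vec Bool) E≡d w)      ∎)
  where
  open import Relation.Binary.Reasoning.Setoid ≈ᶜ-setoid
  E≡d : E ≡ _
  E≡d = trans (sym (cong (_∸ 1) (trans (cong length e) (length-monic w)))) deg≡d
  monic-subst : ∀ {D E} (e : D ≡ E) (w : Vec Bool D) → monic (subst (Vec Bool) e w) ≡ monic w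
  monic-subst refl w = refl

short⊕monic : ∀ {m} (c : Vec Bool m) ys → length ys ≤ m → ∃ λ (c′ : Vec Bool m) → ys ⊕ monic c ≡ monic c′
short⊕monic c        []       _         = c , refl
short⊕monic (c ∷ cs) (y ∷ ys) (s≤s ys≤) with short⊕monic cs ys ys≤
... | c′ , e = (y xor c) ∷ c′ , cong ((y xor c) ∷_) e

monic-⊗ : ∀ {D E} (w : Vec Bool D) (v : Vec Bool E) → ∃ λ (u : Vec Bool (D + E)) → monic w ⊗ monic v ≡ monic u
monic-⊗ []      v = v , monic⊕x v
  where
  ⊕-[] : ∀ ys → ys ⊕ [] ≡ ys
  ⊕-[] []       = refl
  ⊕-[] (y ∷ ys) = refl
  monic⊕x : ∀ {E} (v : Vec Bool E) → monic v ⊕ (false ∷ []) ≡ monic v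
  monic⊕x []      = refl
  monic⊕x (x ∷ v) = cong₂ _∷_ (𝔹.xor-identityʳ x) (⊕-[] (monic v))
monic-⊗ {suc D} {E} (x ∷ w) v =
  proj₁ low , trans (cong (λ z → x·v ⊕ (false ∷ z)) (proj₂ rec)) (proj₂ low)
  where
  x·v = if x then monic v else []
  scaled-short : ∀ x → length (if x then monic v else []) ≤ suc (D + E)
  scaled-short true  = ℕₚ.≤-trans (ℕₚ.≤-reflexive (length-monic v)) (s≤s (ℕₚ.m≤n+m E D))
  scaled-short false = z≤n
  rec = monic-⊗ w v
  low = short⊕monic (false ∷ proj₁ rec) x·v (scaled-short x)

BezoutGcd : Poly → Poly → Set
BezoutGcd a b = ∃ λ g → g ∣ᶜ a × g ∣ᶜ b × ∃₂ λ u v → (u ⊗ a) ⊕ (v ⊗ b) ≈ᶜ g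

-- Euclid's algorithm: replace (a, m) by (m, a mod m), which strictly lowers the degree of the modulus.
euclid : ∀ D (w : Vec Bool D) a → BezoutGcd a (monic w)
euclid = <-rec (λ D → ∀ (w : Vec Bool D) a → BezoutGcd a (monic w)) step
  where
  step : ∀ D → (∀ {E} → E < D → ∀ (w : Vec Bool E) a → BezoutGcd a (monic w)) →
         ∀ (w : Vec Bool D) a → BezoutGcd a (monic w)
  step D rec w a with rem w a ≟ᵛ 0ᵛ D | norm≡[]⊎monic (toList (rem w a))
  ... | yes r≡0 | _ = monic w , Equivalence.to (rem≡0⇔∣ᶜ w a) r≡0 , ∣ᶜ-refl (monic w) , [] , 1ₚ , ⊗-identityˡ (monic w)
  ... | no r≢0 | inj₁ e = ⊥-elim (r≢0 (toList-≈ᶜ-injective _ _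
          (≈ᶜ-trans (≈ᶜ-sym (norm-≈ᶜ (toList (rem w a)))) (≈ᶜ-trans (≡⇒≈ᶜ e) (≈ᶜ-sym (toList-0ᵛ D))))))
  ... | no _ | inj₂ (E , w′ , e) with rec E<D w′ (monic w)
    where
    E<D : E < D
    E<D = begin-strict
      E                         <⟨ ℕₚ.n<1+n E ⟩
      suc E                     ≡⟨ sym (length-monic w′) ⟩
      length (monic w′)         ≡⟨ cong length (sym e) ⟩
      length (norm r)           ≤⟨ length-norm r ⟩
      length r                  ≡⟨ Vecₚ.length-toList (rem w a) ⟩
      D                         ∎
      where
      open ℕₚ.≤-Reasoning
      r = toList (rem w a)
  ... | g , g∣m , g∣r , u , v , um+vr≈g = g , g∣a , g∣m , v , u ⊕ (v ⊗ q) , (begin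
    (v ⊗ a) ⊕ ((u ⊕ (v ⊗ q)) ⊗ m)
      ≈⟨ solve 5 (λ v a u q m → (v :* a) :+ ((u :+ (v :* q)) :* m) := (u :* m) :+ (v :* (a :+ (q :* m)))) ≈ᶜ-refl v a u q m ⟩
    (u ⊗ m) ⊕ (v ⊗ (a ⊕ (q ⊗ m)))    ≈⟨ ⊕-cong (≈ᶜ-refl {u ⊗ m}) (⊗-congʳ v (≈ᶜ-sym r≈a⊕qm)) ⟩
    (u ⊗ m) ⊕ (v ⊗ monic w′)         ≈⟨ um+vr≈g ⟩
    g                                ∎)
    where
    open F₂[x]-Solver
    open import Relation.Binary.Reasoning.Setoid ≈ᶜ-setoid
    q = quot w a
    m = monic w
    r≈monic : toList (rem w a) ≈ᶜ monic w′
    r≈monic = ≈ᶜ-trans (≈ᶜ-sym (norm-≈ᶜ _)) (≡⇒≈ᶜ e)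
    r≈a⊕qm : monic w′ ≈ᶜ a ⊕ (q ⊗ m)
    r≈a⊕qm = ≈ᶜ-trans (≈ᶜ-sym r≈monic) (≈ᶜ-trans
      (solve 2 (λ r qm → r := (qm :+ r) :+ qm) ≈ᶜ-refl (toList (rem w a)) (q ⊗ m))
      (⊕-cong (≈ᶜ-sym (division w a)) ≈ᶜ-refl))
    g∣a : g ∣ᶜ a
    g∣a = ∣ᶜ-respʳ (≈ᶜ-sym (division w a)) (∣ᶜ-⊕ (∣ᶜ-trans g∣m (q , ≈ᶜ-refl)) (∣ᶜ-respʳ (≈ᶜ-sym r≈monic) g∣r))

coprime⇒Bezout : ∀ {D E} p q (w : Vec Bool D) (v : Vec Bool E) →
  p ≈ᶜ monic w → q ≈ᶜ monic v → Coprime p q → Bezout (monic w) (monic v)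
coprime⇒Bezout {E = E} p q w v p≈ q≈ coprime with euclid E v (monic w)
... | g , g∣p , g∣q , u , u′ , bz =
  u , u′ , ≈ᶜ-trans bz (≈⇒≈ᶜ (coprime g (∣ᶜ⇒∣ (∣ᶜ-respʳ (≈ᶜ-sym p≈) g∣p))
                                         (∣ᶜ⇒∣ (∣ᶜ-respʳ (≈ᶜ-sym q≈) g∣q))))

-- Counting polynomials of degree < n

count : ∀ {A : Set} → (A → Bool) → List A → ℕ
count P []       = 0
count P (x ∷ xs) = (if P x then 1 else 0) + count P xs

module _ {A : Set} where

  count-++ : ∀ (P : A → Bool) xs ys → count P (xs ++ ys) ≡ count P xs + count P ys
  count-++ P []       ys = refl
  count-++ P (x ∷ xs) ys = trans (cong ((if P x then 1 else 0) +_) (count-++ P xs ys)) (sym (ℕₚ.+-assoc (if P x then 1 else 0) _ _))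

  count-map : ∀ {B : Set} (P : B → Bool) (g : A → B) xs → count P (List.map g xs) ≡ count (λ x → P (g x)) xs
  count-map P g []       = refl
  count-map P g (x ∷ xs) = cong ((if P (g x) then 1 else 0) +_) (count-map P g xs)

  count-cong : ∀ {P Q : A → Bool} → (∀ x → P x ≡ Q x) → ∀ xs → count P xs ≡ count Q xs
  count-cong P≡Q []       = refl
  count-cong P≡Q (x ∷ xs) = cong₂ _+_ (cong (λ b → if b then 1 else 0) (P≡Q x)) (count-cong P≡Q xs)

  count-mono : ∀ {P Q : A → Bool} → (∀ x → T (P x) → T (Q x)) → ∀ xs → count P xs ≤ count Q xs
  count-mono P⇒Q []                   = z≤n
  count-mono {P} {Q} P⇒Q (x ∷ xs) with P x | Q x | P⇒Q x
  ... | true  | true  | _   = s≤s (count-mono P⇒Q xs)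
  ... | true  | false | imp = ⊥-elim (imp _)
  ... | false | true  | _   = ℕₚ.m≤n⇒m≤1+n (count-mono P⇒Q xs)
  ... | false | false | _   = count-mono P⇒Q xs

  count-split : ∀ (P Q : A → Bool) xs → count P xs ≡ count (λ x → P x ∧ Q x) xs + count (λ x → P x ∧ not (Q x)) xs
  count-split P Q []       = refl
  count-split P Q (x ∷ xs) with P x | Q x
  ... | true  | true  = cong suc (count-split P Q xs)
  ... | true  | false = trans (cong suc (count-split P Q xs)) (sym (ℕₚ.+-suc _ _))
  ... | false | _     = count-split P Q xs

  count-∨-disjoint : ∀ (P Q : A → Bool) → (∀ x → T (P x) → T (Q x) → ⊥) → ∀ xs →
    count (λ x → P x ∨ Q x) xs ≡ count P xs + count Q xs
  count-∨-disjoint P Q disj []       = refl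
  count-∨-disjoint P Q disj (x ∷ xs) with P x | Q x | disj x
  ... | true  | true  | d = ⊥-elim (d _ _)
  ... | true  | false | _ = cong suc (count-∨-disjoint P Q disj xs)
  ... | false | true  | _ = trans (cong suc (count-∨-disjoint P Q disj xs)) (sym (ℕₚ.+-suc _ _))
  ... | false | false | _ = count-∨-disjoint P Q disj xs

  count-false : ∀ xs → count (λ (_ : A) → false) xs ≡ 0
  count-false []       = refl
  count-false (x ∷ xs) = count-false xs

  count≥1 : ∀ (P : A → Bool) {x xs} → x ∈ xs → T (P x) → 1 ≤ count P xs
  count≥1 P {xs = y ∷ xs} (here refl) Px with P y
  ... | true = s≤s z≤n
  count≥1 P {xs = y ∷ xs} (there x∈) Px = ℕₚ.≤-trans (count≥1 P x∈ Px) (ℕₚ.m≤n+m _ _)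

  count-none : ∀ (P : A → Bool) {xs} → All (λ y → ¬ T (P y)) xs → count P xs ≡ 0
  count-none P {[]}     []            = refl
  count-none P {y ∷ xs} (¬Py ∷ ¬Pxs) with P y
  ... | true  = ⊥-elim (¬Py _)
  ... | false = count-none P ¬Pxs

  count≤1 : ∀ (P : A → Bool) {xs} → Unique xs → (∀ x y → T (P x) → T (P y) → x ≡ y) → count P xs ≤ 1
  count≤1 P {[]}     _            _      = z≤n
  count≤1 P {x ∷ xs} (x∉xs ∷ uxs) P-once with P x in Px
  ... | false = count≤1 P uxs P-once
  ... | true  = ℕₚ.≤-reflexive (cong suc (count-none P
                  (All.map (λ x≢y Py → x≢y (P-once _ _ (Equivalence.from 𝔹.T-≡ Px) Py)) x∉xs)))

  count-≤-length : (_≟_ : DecidableEquality A) → ∀ (P : A → Bool) {xs} → Unique xs → ∀ L →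
    (∀ x → T (P x) → x ∈ L) → count P xs ≤ length L
  count-≤-length _≟_ P {xs} uxs [] P⊆L = ℕₚ.≤-reflexive (trans
    (count-cong (λ x → P≡false x) xs) (count-false xs))
    where
    P≡false : ∀ x → P x ≡ false
    P≡false x with P x in Px
    ... | true  with () ← P⊆L x (Equivalence.from 𝔹.T-≡ Px)
    ... | false = refl
  count-≤-length _≟_ P {xs} uxs (y ∷ L) P⊆L = begin
    count P xs                                          ≡⟨ count-split P (λ x → ⌊ x ≟ y ⌋) xs ⟩
    count (λ x → P x ∧ ⌊ x ≟ y ⌋) xs + count (λ x → P x ∧ not ⌊ x ≟ y ⌋) xs
      ≤⟨ ℕₚ.+-mono-≤ (count≤1 _ uxs only-y) (count-≤-length _≟_ _ uxs L in-L) ⟩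
    1 + length L                                        ∎
    where
    open ℕₚ.≤-Reasoning
    only-y : ∀ a b → T (P a ∧ ⌊ a ≟ y ⌋) → T (P b ∧ ⌊ b ≟ y ⌋) → a ≡ b
    only-y a b Ta Tb = trans (toWitness (proj₂ (Equivalence.to (𝔹.T-∧ {P a}) Ta)))
                             (sym (toWitness (proj₂ (Equivalence.to (𝔹.T-∧ {P b}) Tb))))
    in-L : ∀ x → T (P x ∧ not ⌊ x ≟ y ⌋) → x ∈ L
    in-L x T∧ with Equivalence.to (𝔹.T-∧ {P x}) T∧
    ... | Px , x≢y with P⊆L x Px
    ...   | here x≡y = ⊥-elim (toWitnessFalse x≢y x≡y)
    ...   | there x∈L = x∈L

allVecs : ∀ n → List (Vec Bool n)
allVecs zero    = [] ∷ []
allVecs (suc n) = List.map (_∷ʳ false) (allVecs n) ++ List.map (_∷ʳ true) (allVecs n)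

allVecs-complete : ∀ n (v : Vec Bool n) → v ∈ allVecs n
allVecs-complete zero    []  = here refl
allVecs-complete (suc n) v with Vec.initLast v
... | u , false , refl = ∈-++⁺ˡ (∈-map⁺ (_∷ʳ false) (allVecs-complete n u))
... | u , true  , refl = ∈-++⁺ʳ (List.map (_∷ʳ false) (allVecs n)) (∈-map⁺ (_∷ʳ true) (allVecs-complete n u))

allVecs-unique : ∀ n → Unique (allVecs n)
allVecs-unique zero    = [] ∷ []
allVecs-unique (suc n) = Uniqueₚ.++⁺ (Uniqueₚ.map⁺ (Vecₚ.∷ʳ-injectiveˡ _ _) (allVecs-unique n))
                                      (Uniqueₚ.map⁺ (Vecₚ.∷ʳ-injectiveˡ _ _) (allVecs-unique n)) disjoint
  where
  disjoint : ∀ {v} → ¬ (v ∈ List.map (_∷ʳ false) (allVecs n) × v ∈ List.map (_∷ʳ true) (allVecs n))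
  disjoint (v∈₀ , v∈₁) with ∈-map⁻ (_∷ʳ false) v∈₀ | ∈-map⁻ (_∷ʳ true) v∈₁
  ... | x , _ , refl | y , _ , e with () ← Vecₚ.∷ʳ-injectiveʳ x y e

toList-∷ʳ : ∀ {n} (v : Vec Bool n) b → toList (v ∷ʳ b) ≡ toList v ++ (b ∷ [])
toList-∷ʳ []      b = refl
toList-∷ʳ (x ∷ v) b = cong (x ∷_) (toList-∷ʳ v b)

⌊⌋-⇔ : ∀ {A B : Set} → A ⇔ B → (a? : Dec A) (b? : Dec B) → ⌊ a? ⌋ ≡ ⌊ b? ⌋
⌊⌋-⇔ A⇔B a? b? = trans (isYes≗does a?) (trans (does-⇔ A⇔B a? b?) (sym (isYes≗does b?)))

congruent? : ∀ {D n} → Vec Bool D → Poly → Vec Bool n → Bool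
congruent? v e f = ⌊ rem v (toList f) ≟ᵛ rem v e ⌋

module _ {D} (w : Vec Bool D) where

  inFibre : ∀ {n} → Vec Bool D → Vec Bool n → Bool
  inFibre c f = ⌊ rem w (toList f) ≟ᵛ c ⌋

  rem-toList-injective : ∀ {n} → n ≤ D → (f g : Vec Bool n) → rem w (toList f) ≡ rem w (toList g) → f ≡ g
  rem-toList-injective {n} n≤D f g e = toList-≈ᶜ-injective f g (≡⇒≈ᶜ (Listₚ.++-cancelʳ pad (toList f) (toList g) (begin
    toList f ++ pad           ≡⟨ sym (toList-rem-short w (toList f) (D ∸ n) (fits f)) ⟩
    toList (rem w (toList f)) ≡⟨ cong toList e ⟩
    toList (rem w (toList g)) ≡⟨ toList-rem-short w (toList g) (D ∸ n) (fits g) ⟩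
    toList g ++ pad           ∎)))
    where
    open ≡-Reasoning
    pad = List.replicate (D ∸ n) false
    fits : (h : Vec Bool n) → length (toList h) + (D ∸ n) ≡ D
    fits h = trans (cong (_+ (D ∸ n)) (Vecₚ.length-toList h)) (ℕₚ.m+[n∸m]≡n n≤D)

  rem-toList : (c : Vec Bool D) → rem w (toList c) ≡ c
  rem-toList c = toList-≈ᶜ-injective _ c (≡⇒≈ᶜ (trans
    (toList-rem-short w (toList c) 0 (trans (ℕₚ.+-identityʳ _) (Vecₚ.length-toList c)))
    (Listₚ.++-identityʳ (toList c))))

  fibre≤1 : ∀ {n} → n ≤ D → ∀ c → count (inFibre c) (allVecs n) ≤ 1
  fibre≤1 n≤D c = count≤1 (inFibre c) (allVecs-unique _) λ f g Tf Tg →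
    rem-toList-injective n≤D f g (trans (toWitness Tf) (sym (toWitness Tg)))

  fibre-top : ∀ c → count (inFibre c) (allVecs D) ≡ 1
  fibre-top c = ℕₚ.≤-antisym (fibre≤1 ℕₚ.≤-refl c)
    (count≥1 (inFibre c) (allVecs-complete D c) (fromWitness (rem-toList c)))

  toList-∷ʳ-true : ∀ {n} (v : Vec Bool n) → toList (v ∷ʳ true) ≈ᶜ toList v ⊕ toList (0ᵛ n ∷ʳ true)
  toList-∷ʳ-true []      = ≈ᶜ-refl
  toList-∷ʳ-true (x ∷ v) = ∷-cong (sym (𝔹.xor-identityʳ x)) (toList-∷ʳ-true v)

  fibre-∷ʳ-true : ∀ {n} c (v : Vec Bool n) → inFibre c (v ∷ʳ true) ≡ inFibre (c ⊻ rem w (toList (0ᵛ n ∷ʳ true))) v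
  fibre-∷ʳ-true {n} c v = ⌊⌋-⇔ (mk⇔
    (λ e → trans (sym (⊻-cancelʳ _ u)) (cong (_⊻ u) (trans (sym rem-v∷ʳ1) e)))
    (λ e → trans rem-v∷ʳ1 (trans (cong (_⊻ u) e) (⊻-cancelʳ c u)))) _ _
    where
    u = rem w (toList (0ᵛ n ∷ʳ true))
    rem-v∷ʳ1 : rem w (toList (v ∷ʳ true)) ≡ rem w (toList v) ⊻ u
    rem-v∷ʳ1 = trans (rem-cong w (toList-∷ʳ-true v)) (rem-⊕ w (toList v) _)

  fibre-∷ʳ-false : ∀ {n} c (v : Vec Bool n) → inFibre c (v ∷ʳ false) ≡ inFibre c v
  fibre-∷ʳ-false c v = cong (λ r → ⌊ r ≟ᵛ c ⌋)
    (rem-cong w (≈ᶜ-trans (≡⇒≈ᶜ (toList-∷ʳ v false)) (snoc-false (toList v))))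

  fibre-size : ∀ n → D ≤ n → ∀ c → count (inFibre c) (allVecs n) ≡ 2 ^ (n ∸ D)
  fibre-size n D≤n c with ℕₚ.m≤n⇒m<n∨m≡n D≤n
  ... | inj₂ refl = trans (fibre-top c) (cong (2 ^_) (sym (ℕₚ.n∸n≡0 D)))
  fibre-size (suc n) _ c | inj₁ (s≤s D≤n) = begin
    count (inFibre c) (List.map (_∷ʳ false) (allVecs n) ++ List.map (_∷ʳ true) (allVecs n))
      ≡⟨ count-++ (inFibre c) (List.map (_∷ʳ false) (allVecs n)) _ ⟩
    count (inFibre c) (List.map (_∷ʳ false) (allVecs n)) + count (inFibre c) (List.map (_∷ʳ true) (allVecs n))
      ≡⟨ cong₂ _+_ (count-map (inFibre c) (_∷ʳ false) (allVecs n)) (count-map (inFibre c) (_∷ʳ true) (allVecs n)) ⟩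
    count (λ v → inFibre c (v ∷ʳ false)) (allVecs n) + count (λ v → inFibre c (v ∷ʳ true)) (allVecs n)
      ≡⟨ cong₂ _+_ (count-cong (fibre-∷ʳ-false c) (allVecs n)) (count-cong (fibre-∷ʳ-true c) (allVecs n)) ⟩
    count (inFibre c) (allVecs n) + count (inFibre (c ⊻ _)) (allVecs n)
      ≡⟨ cong₂ _+_ (fibre-size n D≤n c) (fibre-size n D≤n _) ⟩
    2 ^ (n ∸ D) + 2 ^ (n ∸ D)
      ≡⟨ cong (2 ^ (n ∸ D) +_) (sym (ℕₚ.+-identityʳ _)) ⟩
    2 ^ suc (n ∸ D)
      ≡⟨ cong (2 ^_) (sym (ℕₚ.+-∸-assoc 1 D≤n)) ⟩
    2 ^ (suc n ∸ D) ∎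
    where open ≡-Reasoning

-- Rational arithmetic

toℚᵘ-/suc : ∀ a b → ℚ.toℚᵘ (ℤ.+ a ℚ./ suc b) ≃ᵘ mkℚᵘ (ℤ.+ a) b
toℚᵘ-/suc a b = ℚₚ.toℚᵘ-fromℚᵘ (mkℚᵘ (ℤ.+ a) b)

ℕ→ℚ-+ : ∀ a b → ℕ→ℚ (a + b) ≡ ℕ→ℚ a ℚ.+ ℕ→ℚ b
ℕ→ℚ-+ a b = ℚₚ.toℚᵘ-injective (ℚᵘₚ.≃-trans (toℚᵘ-/suc (a + b) 0) (ℚᵘₚ.≃-trans sum
  (ℚᵘₚ.≃-sym (ℚᵘₚ.≃-trans (ℚₚ.toℚᵘ-homo-+ (ℕ→ℚ a) (ℕ→ℚ b)) (ℚᵘₚ.+-cong (toℚᵘ-/suc a 0) (toℚᵘ-/suc b 0))))))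
  where
  open ℤ-Solver
  sum : mkℚᵘ (ℤ.+ (a + b)) 0 ≃ᵘ mkℚᵘ (ℤ.+ a) 0 ℚᵘ.+ mkℚᵘ (ℤ.+ b) 0
  sum = *≡* (trans (cong (ℤ._* (ℤ.+ 1 ℤ.* ℤ.+ 1)) (ℤₚ.pos-+ a b))
    (solve 2 (λ x y → (x :+ y) :* (con (ℤ.+ 1) :* con (ℤ.+ 1)) := (x :* con (ℤ.+ 1) :+ y :* con (ℤ.+ 1)) :* con (ℤ.+ 1))
             refl (ℤ.+ a) (ℤ.+ b)))

ℕ→ℚ-* : ∀ a b → ℕ→ℚ (a ℕ.* b) ≡ ℕ→ℚ a ℚ.* ℕ→ℚ b
ℕ→ℚ-* a b = ℚₚ.toℚᵘ-injective (ℚᵘₚ.≃-trans (toℚᵘ-/suc (a ℕ.* b) 0) (ℚᵘₚ.≃-trans product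
  (ℚᵘₚ.≃-sym (ℚᵘₚ.≃-trans (ℚₚ.toℚᵘ-homo-* (ℕ→ℚ a) (ℕ→ℚ b)) (ℚᵘₚ.*-cong (toℚᵘ-/suc a 0) (toℚᵘ-/suc b 0))))))
  where
  open ℤ-Solver
  product : mkℚᵘ (ℤ.+ (a ℕ.* b)) 0 ≃ᵘ mkℚᵘ (ℤ.+ a) 0 ℚᵘ.* mkℚᵘ (ℤ.+ b) 0
  product = *≡* (trans (cong (ℤ._* (ℤ.+ 1 ℤ.* ℤ.+ 1)) (ℤₚ.pos-* a b))
    (solve 2 (λ x y → (x :* y) :* (con (ℤ.+ 1) :* con (ℤ.+ 1)) := (x :* y) :* con (ℤ.+ 1)) refl (ℤ.+ a) (ℤ.+ b)))

/-as-* : ∀ k n .{{_ : ℕ.NonZero n}} → ℤ.+ k ℚ./ n ≡ ℕ→ℚ k ℚ.* (ℤ.+ 1 ℚ./ n)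
/-as-* k (suc m) = ℚₚ.toℚᵘ-injective (ℚᵘₚ.≃-trans (toℚᵘ-/suc k m) (ℚᵘₚ.≃-trans product
  (ℚᵘₚ.≃-sym (ℚᵘₚ.≃-trans (ℚₚ.toℚᵘ-homo-* (ℕ→ℚ k) (ℤ.+ 1 ℚ./ suc m)) (ℚᵘₚ.*-cong (toℚᵘ-/suc k 0) (toℚᵘ-/suc 1 m))))))
  where
  open ℤ-Solver
  product : mkℚᵘ (ℤ.+ k) m ≃ᵘ mkℚᵘ (ℤ.+ k) 0 ℚᵘ.* mkℚᵘ (ℤ.+ 1) m
  product = *≡* (solve 2 (λ x d → x :* (con (ℤ.+ 1) :* d) := (x :* con (ℤ.+ 1)) :* d) refl (ℤ.+ k) (ℤ.+ (suc m)))

1/n*n≡1 : ∀ n .{{_ : ℕ.NonZero n}} → (ℤ.+ 1 ℚ./ n) ℚ.* ℕ→ℚ n ≡ 1ℚ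
1/n*n≡1 (suc m) = ℚₚ.toℚᵘ-injective (ℚᵘₚ.≃-trans (ℚₚ.toℚᵘ-homo-* (ℤ.+ 1 ℚ./ suc m) (ℕ→ℚ (suc m)))
  (ℚᵘₚ.≃-trans (ℚᵘₚ.*-cong (toℚᵘ-/suc 1 m) (toℚᵘ-/suc (suc m) 0)) (ℚᵘₚ.≃-trans cancel (ℚᵘₚ.≃-sym (toℚᵘ-/suc 1 0)))))
  where
  open ℤ-Solver
  cancel : mkℚᵘ (ℤ.+ 1) m ℚᵘ.* mkℚᵘ (ℤ.+ (suc m)) 0 ≃ᵘ mkℚᵘ (ℤ.+ 1) 0
  cancel = *≡* (solve 1 (λ d → (con (ℤ.+ 1) :* d) :* con (ℤ.+ 1) := con (ℤ.+ 1) :* (d :* con (ℤ.+ 1))) refl (ℤ.+ (suc m)))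

ℕ→ℚ-nonNeg : ∀ a → 0ℚ ℚ.≤ ℕ→ℚ a
ℕ→ℚ-nonNeg a = ℚₚ.nonNegative⁻¹ (ℕ→ℚ a) {{ℚₚ.normalize-nonNeg a 1}}

ℕ→ℚ-mono-≤ : ∀ {a b} → a ≤ b → ℕ→ℚ a ℚ.≤ ℕ→ℚ b
ℕ→ℚ-mono-≤ {a} {b} a≤b = begin
  ℕ→ℚ a                      ≡⟨ sym (ℚₚ.+-identityʳ (ℕ→ℚ a)) ⟩
  ℕ→ℚ a ℚ.+ 0ℚ               ≤⟨ ℚₚ.+-monoʳ-≤ (ℕ→ℚ a) (ℕ→ℚ-nonNeg (b ∸ a)) ⟩
  ℕ→ℚ a ℚ.+ ℕ→ℚ (b ∸ a)      ≡⟨ sym (ℕ→ℚ-+ a (b ∸ a)) ⟩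
  ℕ→ℚ (a + (b ∸ a))          ≡⟨ cong ℕ→ℚ (ℕₚ.m+[n∸m]≡n a≤b) ⟩
  ℕ→ℚ b                      ∎
  where open ℚₚ.≤-Reasoning

ℕ→ℚ-mono-< : ∀ {a b} → a < b → ℕ→ℚ a ℚ.< ℕ→ℚ b
ℕ→ℚ-mono-< {a} {b} a<b = begin-strict
  ℕ→ℚ a              ≡⟨ sym (ℚₚ.+-identityʳ (ℕ→ℚ a)) ⟩
  ℕ→ℚ a ℚ.+ 0ℚ       <⟨ ℚₚ.+-monoʳ-< (ℕ→ℚ a) (ℚₚ.positive⁻¹ 1ℚ) ⟩
  ℕ→ℚ a ℚ.+ 1ℚ       ≡⟨ sym (ℕ→ℚ-+ a 1) ⟩
  ℕ→ℚ (a + 1)        ≡⟨ cong ℕ→ℚ (ℕₚ.+-comm a 1) ⟩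
  ℕ→ℚ (suc a)        ≤⟨ ℕ→ℚ-mono-≤ a<b ⟩
  ℕ→ℚ b              ∎
  where open ℚₚ.≤-Reasoning

-- Opaque, like the rational quantities of the sieve below: unfolding rational arithmetic
-- during unification is prohibitively slow.
opaque
  ½^_ : ℕ → ℚ
  ½^ D = 1 /2^ D

  /2^-as-* : ∀ k d → k /2^ d ≡ ℕ→ℚ k ℚ.* ½^ d
  /2^-as-* k d = /-as-* k (2 ^ d) {{ℕₚ.m^n≢0 2 d}}

  ½^-inverse : ∀ D → ½^ D ℚ.* ℕ→ℚ (2 ^ D) ≡ 1ℚ
  ½^-inverse D = 1/n*n≡1 (2 ^ D) {{ℕₚ.m^n≢0 2 D}}

  ½^-positive : ∀ D → ℚ.Positive (½^ D)
  ½^-positive D = ℚₚ.normalize-pos 1 (2 ^ D) {{ℕₚ.m^n≢0 2 D}}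

ℕ→ℚ-2^-+ : ∀ D E → ℕ→ℚ (2 ^ (D + E)) ≡ ℕ→ℚ (2 ^ D) ℚ.* ℕ→ℚ (2 ^ E)
ℕ→ℚ-2^-+ D E = trans (cong ℕ→ℚ (ℕₚ.^-distribˡ-+-* 2 D E)) (ℕ→ℚ-* (2 ^ D) (2 ^ E))

½^-+ : ∀ D E → ½^ (D + E) ≡ ½^ D ℚ.* ½^ E
½^-+ D E = begin
  i                                                       ≡⟨ sym (ℚₚ.*-identityʳ i) ⟩
  i ℚ.* 1ℚ                                                ≡⟨ cong (i ℚ.*_) (sym (cong₂ ℚ._*_ (½^-inverse D) (½^-inverse E))) ⟩
  i ℚ.* ((½^ D ℚ.* ℕ→ℚ (2 ^ D)) ℚ.* (½^ E ℚ.* ℕ→ℚ (2 ^ E)))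
    ≡⟨ solve 5 (λ i a b c d → i :* ((a :* b) :* (c :* d)) := (i :* (b :* d)) :* (a :* c)) refl i (½^ D) _ (½^ E) _ ⟩
  (i ℚ.* (ℕ→ℚ (2 ^ D) ℚ.* ℕ→ℚ (2 ^ E))) ℚ.* (½^ D ℚ.* ½^ E)
    ≡⟨ cong (λ c → (i ℚ.* c) ℚ.* (½^ D ℚ.* ½^ E)) (sym (ℕ→ℚ-2^-+ D E)) ⟩
  (i ℚ.* ℕ→ℚ (2 ^ (D + E))) ℚ.* (½^ D ℚ.* ½^ E)         ≡⟨ cong (ℚ._* (½^ D ℚ.* ½^ E)) (½^-inverse (D + E)) ⟩
  1ℚ ℚ.* (½^ D ℚ.* ½^ E)                                  ≡⟨ ℚₚ.*-identityˡ _ ⟩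
  ½^ D ℚ.* ½^ E                                           ∎
  where
  open ≡-Reasoning
  open ℚ-Solver
  i = ½^ (D + E)

2^*½^ : ∀ n D → D ≤ n → ℕ→ℚ (2 ^ n) ℚ.* ½^ D ≡ ℕ→ℚ (2 ^ (n ∸ D))
2^*½^ n D D≤n = begin
  ℕ→ℚ (2 ^ n) ℚ.* ½^ D                             ≡⟨ cong (λ m → ℕ→ℚ (2 ^ m) ℚ.* ½^ D) (sym (ℕₚ.m∸n+n≡m D≤n)) ⟩
  ℕ→ℚ (2 ^ (n ∸ D + D)) ℚ.* ½^ D                   ≡⟨ cong (ℚ._* ½^ D) (ℕ→ℚ-2^-+ (n ∸ D) D) ⟩
  (ℕ→ℚ (2 ^ (n ∸ D)) ℚ.* ℕ→ℚ (2 ^ D)) ℚ.* ½^ D     ≡⟨ solve 3 (λ a b c → (a :* b) :* c := a :* (c :* b)) refl (ℕ→ℚ (2 ^ (n ∸ D))) _ _ ⟩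
  ℕ→ℚ (2 ^ (n ∸ D)) ℚ.* (½^ D ℚ.* ℕ→ℚ (2 ^ D))     ≡⟨ cong (ℕ→ℚ (2 ^ (n ∸ D)) ℚ.*_) (½^-inverse D) ⟩
  ℕ→ℚ (2 ^ (n ∸ D)) ℚ.* 1ℚ                          ≡⟨ ℚₚ.*-identityʳ _ ⟩
  ℕ→ℚ (2 ^ (n ∸ D))                                 ∎
  where
  open ≡-Reasoning
  open ℚ-Solver

2^*½^-pos : ∀ n D → 0ℚ ℚ.< ℕ→ℚ (2 ^ n) ℚ.* ½^ D
2^*½^-pos n D = ℚₚ.positive⁻¹ _ {{ℚₚ.pos*pos⇒pos (ℕ→ℚ (2 ^ n)) {{ℚₚ.normalize-pos (2 ^ n) 1 {{_}} {{ℕₚ.m^n≢0 2 n}}}}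
                                                   (½^ D) {{½^-positive D}}}}

2^*½^<1 : ∀ n D → n < D → ℕ→ℚ (2 ^ n) ℚ.* ½^ D ℚ.< 1ℚ
2^*½^<1 n D n<D = ℚₚ.*-cancelʳ-<-nonNeg (ℕ→ℚ (2 ^ m)) {{ℚₚ.normalize-nonNeg (2 ^ m) 1}} (begin-strict
  (ℕ→ℚ (2 ^ n) ℚ.* ½^ D) ℚ.* ℕ→ℚ (2 ^ m)    ≡⟨ solve 3 (λ a b c → (a :* b) :* c := b :* (a :* c)) refl (ℕ→ℚ (2 ^ n)) (½^ D) _ ⟩
  ½^ D ℚ.* (ℕ→ℚ (2 ^ n) ℚ.* ℕ→ℚ (2 ^ m))    ≡⟨ cong (½^ D ℚ.*_) (sym (ℕ→ℚ-2^-+ n m)) ⟩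
  ½^ D ℚ.* ℕ→ℚ (2 ^ (n + m))                ≡⟨ cong (λ e → ½^ D ℚ.* ℕ→ℚ (2 ^ e)) (ℕₚ.m+[n∸m]≡n (ℕₚ.<⇒≤ n<D)) ⟩
  ½^ D ℚ.* ℕ→ℚ (2 ^ D)                      ≡⟨ ½^-inverse D ⟩
  ℕ→ℚ 1                                    <⟨ ℕ→ℚ-mono-< (ℕₚ.^-monoʳ-≤ 2 (ℕₚ.m<n⇒0<n∸m n<D)) ⟩
  ℕ→ℚ (2 ^ m)                               ≡⟨ sym (ℚₚ.*-identityˡ _) ⟩
  1ℚ ℚ.* ℕ→ℚ (2 ^ m)                        ∎)
  where
  open ℚₚ.≤-Reasoning
  open ℚ-Solver
  m = D ∸ n

∑-cong : ∀ m {f g : Fin m → ℚ} → (∀ i → f i ≡ g i) → ∑ m f ≡ ∑ m g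
∑-cong zero    f≡g = refl
∑-cong (suc m) f≡g = cong₂ ℚ._+_ (f≡g Fin.zero) (∑-cong m (λ i → f≡g (Fin.suc i)))

∑-mono-≤ : ∀ m {f g : Fin m → ℚ} → (∀ i → f i ℚ.≤ g i) → ∑ m f ℚ.≤ ∑ m g
∑-mono-≤ zero    f≤g = ℚₚ.≤-refl
∑-mono-≤ (suc m) f≤g = ℚₚ.+-mono-≤ (f≤g Fin.zero) (∑-mono-≤ m (λ i → f≤g (Fin.suc i)))

∑-mono-< : ∀ m {f g : Fin m → ℚ} (j : Fin m) → f j ℚ.< g j → (∀ i → f i ℚ.≤ g i) → ∑ m f ℚ.< ∑ m g
∑-mono-< (suc m) Fin.zero    fj<gj f≤g = ℚₚ.+-mono-<-≤ fj<gj (∑-mono-≤ m (λ i → f≤g (Fin.suc i)))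
∑-mono-< (suc m) (Fin.suc j) fj<gj f≤g = ℚₚ.+-mono-≤-< (f≤g Fin.zero) (∑-mono-< m j fj<gj (λ i → f≤g (Fin.suc i)))

∑-+ : ∀ m (f g : Fin m → ℚ) → ∑ m (λ i → f i ℚ.+ g i) ≡ ∑ m f ℚ.+ ∑ m g
∑-+ zero    f g = sym (ℚₚ.+-identityʳ 0ℚ)
∑-+ (suc m) f g = trans (cong (f Fin.zero ℚ.+ g Fin.zero ℚ.+_) (∑-+ m _ _))
  (solve 4 (λ a b c d → (a :+ b) :+ (c :+ d) := (a :+ c) :+ (b :+ d)) refl (f Fin.zero) (g Fin.zero) _ _)
  where open ℚ-Solver

∑-*ˡ : ∀ m x (f : Fin m → ℚ) → ∑ m (λ i → x ℚ.* f i) ≡ x ℚ.* ∑ m f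
∑-*ˡ zero    x f = sym (ℚₚ.*-zeroʳ x)
∑-*ˡ (suc m) x f = trans (cong (x ℚ.* f Fin.zero ℚ.+_) (∑-*ˡ m x _)) (sym (ℚₚ.*-distribˡ-+ x (f Fin.zero) _))

∑-const : ∀ m x → ∑ m (λ _ → x) ≡ ℕ→ℚ m ℚ.* x
∑-const zero    x = sym (ℚₚ.*-zeroˡ x)
∑-const (suc m) x = begin
  x ℚ.+ ∑ m (λ _ → x)            ≡⟨ cong (x ℚ.+_) (∑-const m x) ⟩
  x ℚ.+ ℕ→ℚ m ℚ.* x              ≡⟨ solve 2 (λ x m → x :+ m :* x := (con 1ℚ :+ m) :* x) refl x (ℕ→ℚ m) ⟩
  (1ℚ ℚ.+ ℕ→ℚ m) ℚ.* x           ≡⟨ cong (ℚ._* x) (sym (ℕ→ℚ-+ 1 m)) ⟩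
  ℕ→ℚ (suc m) ℚ.* x              ∎
  where
  open ≡-Reasoning
  open ℚ-Solver

∑ℕ : ∀ m → (Fin m → ℕ) → ℕ
∑ℕ zero    g = 0
∑ℕ (suc m) g = g Fin.zero + ∑ℕ m (λ i → g (Fin.suc i))

∑ℕ-cong : ∀ m {f g : Fin m → ℕ} → (∀ i → f i ≡ g i) → ∑ℕ m f ≡ ∑ℕ m g
∑ℕ-cong zero    f≡g = refl
∑ℕ-cong (suc m) f≡g = cong₂ _+_ (f≡g Fin.zero) (∑ℕ-cong m (λ i → f≡g (Fin.suc i)))

ℕ→ℚ-∑ℕ : ∀ m (g : Fin m → ℕ) → ℕ→ℚ (∑ℕ m g) ≡ ∑ m (λ i → ℕ→ℚ (g i))
ℕ→ℚ-∑ℕ zero    g = refl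
ℕ→ℚ-∑ℕ (suc m) g = trans (ℕ→ℚ-+ (g Fin.zero) _) (cong (ℕ→ℚ (g Fin.zero) ℚ.+_) (ℕ→ℚ-∑ℕ m _))

record Near (b x y : ℚ) : Set where
  constructor near
  field
    lower : y ℚ.- b ℚ.< x
    upper : x ℚ.< y ℚ.+ b
open Near

near-exact : ∀ {x y} → x ≡ y → Near 1ℚ x (y ℚ.* 1ℚ)
near-exact {y = y} refl rewrite ℚₚ.*-identityʳ y = near
  (ℚₚ.<-respʳ-≡ (ℚₚ.+-identityʳ y) (ℚₚ.+-monoʳ-< y (ℚₚ.negative⁻¹ (ℚ.- 1ℚ))))
  (ℚₚ.<-respˡ-≡ (ℚₚ.+-identityʳ y) (ℚₚ.+-monoʳ-< y (ℚₚ.positive⁻¹ 1ℚ)))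

near-small : ∀ {x y} → 0ℚ ℚ.< y → y ℚ.< 1ℚ → 0ℚ ℚ.≤ x → x ℚ.≤ 1ℚ → Near 1ℚ x (y ℚ.* 1ℚ)
near-small {x} {y} 0<y y<1 0≤x x≤1 rewrite ℚₚ.*-identityʳ y = near
  (ℚₚ.<-≤-trans (ℚₚ.<-respʳ-≡ (ℚₚ.+-inverseʳ 1ℚ) (ℚₚ.+-monoˡ-< (ℚ.- 1ℚ) y<1)) 0≤x)
  (ℚₚ.≤-<-trans x≤1 (ℚₚ.<-respˡ-≡ (ℚₚ.+-identityˡ 1ℚ) (ℚₚ.+-monoˡ-< 1ℚ 0<y)))

-- Removing K classes, each of size about M h P, from one of size about M P.
near-step : ∀ K {B M h P X Z} (Y : Fin K → ℚ) → X ≡ Z ℚ.+ ∑ K Y →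
  Near B X (M ℚ.* P) → (∀ a → Near B (Y a) (M ℚ.* h ℚ.* P)) →
  Near ((1ℚ ℚ.+ ℕ→ℚ K) ℚ.* B) Z (M ℚ.* ((1ℚ ℚ.- ℕ→ℚ K ℚ.* h) ℚ.* P))
near-step K {B} {M} {h} {P} {X} {Z} Y X≡Z+ΣY (near X>MP-B X<MP+B) Y-near = near Z-lower Z-upper
  where
  open ℚₚ.≤-Reasoning
  open ℚ-Solver
  κ = ℕ→ℚ K
  Z≡X-ΣY : Z ≡ X ℚ.- ∑ K Y
  Z≡X-ΣY = trans (solve 2 (λ Z S → Z := (Z :+ S) :- S) refl Z (∑ K Y)) (cong (ℚ._- ∑ K Y) (sym X≡Z+ΣY))
  ΣY≤ : ∑ K Y ℚ.≤ κ ℚ.* (M ℚ.* h ℚ.* P ℚ.+ B)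
  ΣY≤ = ℚₚ.≤-trans (∑-mono-≤ K (λ a → ℚₚ.<⇒≤ (upper (Y-near a)))) (ℚₚ.≤-reflexive (∑-const K _))
  ΣY≥ : κ ℚ.* (M ℚ.* h ℚ.* P ℚ.- B) ℚ.≤ ∑ K Y
  ΣY≥ = ℚₚ.≤-trans (ℚₚ.≤-reflexive (sym (∑-const K _))) (∑-mono-≤ K (λ a → ℚₚ.<⇒≤ (lower (Y-near a))))
  Z-lower : M ℚ.* ((1ℚ ℚ.- κ ℚ.* h) ℚ.* P) ℚ.- (1ℚ ℚ.+ κ) ℚ.* B ℚ.< Z
  Z-lower = begin-strict
    M ℚ.* ((1ℚ ℚ.- κ ℚ.* h) ℚ.* P) ℚ.- (1ℚ ℚ.+ κ) ℚ.* B
      ≡⟨ solve 5 (λ M h P B κ → M :* ((con 1ℚ :- κ :* h) :* P) :- (con 1ℚ :+ κ) :* B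
                               := (M :* P :- B) :- κ :* (M :* h :* P :+ B)) refl M h P B κ ⟩
    (M ℚ.* P ℚ.- B) ℚ.- κ ℚ.* (M ℚ.* h ℚ.* P ℚ.+ B)
      <⟨ ℚₚ.+-mono-<-≤ X>MP-B (ℚₚ.neg-antimono-≤ ΣY≤) ⟩
    X ℚ.- ∑ K Y
      ≡⟨ sym Z≡X-ΣY ⟩
    Z ∎
  Z-upper : Z ℚ.< M ℚ.* ((1ℚ ℚ.- κ ℚ.* h) ℚ.* P) ℚ.+ (1ℚ ℚ.+ κ) ℚ.* B
  Z-upper = begin-strict
    Z
      ≡⟨ Z≡X-ΣY ⟩
    X ℚ.- ∑ K Y
      <⟨ ℚₚ.+-mono-<-≤ X<MP+B (ℚₚ.neg-antimono-≤ ΣY≥) ⟩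
    (M ℚ.* P ℚ.+ B) ℚ.- κ ℚ.* (M ℚ.* h ℚ.* P ℚ.- B)
      ≡⟨ solve 5 (λ M h P B κ → (M :* P :+ B) :- κ :* (M :* h :* P :- B)
                               := M :* ((con 1ℚ :- κ :* h) :* P) :+ (con 1ℚ :+ κ) :* B) refl M h P B κ ⟩
    M ℚ.* ((1ℚ ℚ.- κ ℚ.* h) ℚ.* P) ℚ.+ (1ℚ ℚ.+ κ) ℚ.* B ∎

lower-step : ∀ K {B M h P X Z} (Y : Fin K → ℚ) → X ≡ Z ℚ.+ ∑ K Y →
  M ℚ.* P ℚ.- B ℚ.+ 1ℚ ℚ.≤ X → (∀ a → Y a ℚ.< M ℚ.* h ℚ.* P ℚ.+ B) →
  M ℚ.* ((1ℚ ℚ.- ℕ→ℚ K ℚ.* h) ℚ.* P) ℚ.- (1ℚ ℚ.+ ℕ→ℚ K) ℚ.* B ℚ.+ 1ℚ ℚ.≤ Z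
lower-step K {B} {M} {h} {P} {X} {Z} Y X≡Z+ΣY X≥ Y< = begin
  M ℚ.* ((1ℚ ℚ.- κ ℚ.* h) ℚ.* P) ℚ.- (1ℚ ℚ.+ κ) ℚ.* B ℚ.+ 1ℚ
    ≡⟨ solve 5 (λ M h P B κ → M :* ((con 1ℚ :- κ :* h) :* P) :- (con 1ℚ :+ κ) :* B :+ con 1ℚ
                             := (M :* P :- B :+ con 1ℚ) :- κ :* (M :* h :* P :+ B)) refl M h P B κ ⟩
  (M ℚ.* P ℚ.- B ℚ.+ 1ℚ) ℚ.- κ ℚ.* (M ℚ.* h ℚ.* P ℚ.+ B)
    ≤⟨ ℚₚ.+-mono-≤ X≥ (ℚₚ.neg-antimono-≤ ΣY≤) ⟩
  X ℚ.- ∑ K Y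
    ≡⟨ cong (ℚ._- ∑ K Y) X≡Z+ΣY ⟩
  Z ℚ.+ ∑ K Y ℚ.- ∑ K Y
    ≡⟨ solve 2 (λ Z S → Z :+ S :- S := Z) refl Z (∑ K Y) ⟩
  Z ∎
  where
  open ℚₚ.≤-Reasoning
  open ℚ-Solver
  κ = ℕ→ℚ K
  ΣY≤ : ∑ K Y ℚ.≤ κ ℚ.* (M ℚ.* h ℚ.* P ℚ.+ B)
  ΣY≤ = ℚₚ.≤-trans (∑-mono-≤ K (λ a → ℚₚ.<⇒≤ (Y< a))) (ℚₚ.≤-reflexive (∑-const K _))

-- The sieve

anyᶠ : ∀ m → (Fin m → Bool) → Bool
anyᶠ zero    g = false
anyᶠ (suc m) g = g Fin.zero ∨ anyᶠ m (λ a → g (Fin.suc a))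

anyᶠ-witness : ∀ m (g : Fin m → Bool) → T (anyᶠ m g) → ∃ λ a → T (g a)
anyᶠ-witness (suc m) g any with g Fin.zero in g₀
... | true  = Fin.zero , Equivalence.from 𝔹.T-≡ g₀
... | false = let a , ga = anyᶠ-witness m (λ a → g (Fin.suc a)) any in Fin.suc a , ga

anyᶠ-intro : ∀ m (g : Fin m → Bool) a → T (g a) → T (anyᶠ m g)
anyᶠ-intro (suc m) g Fin.zero    ga = Equivalence.from 𝔹.T-∨ (inj₁ ga)
anyᶠ-intro (suc m) g (Fin.suc a) ga = Equivalence.from (𝔹.T-∨ {g Fin.zero}) (inj₂ (anyᶠ-intro m _ a ga))

∧-anyᶠ : ∀ m x (g : Fin m → Bool) → x ∧ anyᶠ m g ≡ anyᶠ m (λ a → x ∧ g a)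
∧-anyᶠ zero    x g = 𝔹.∧-zeroʳ x
∧-anyᶠ (suc m) x g = trans (𝔹.∧-distribˡ-∨ x (g Fin.zero) _) (cong (x ∧ g Fin.zero ∨_) (∧-anyᶠ m x _))

anyᶠ-cong : ∀ m {g h : Fin m → Bool} → (∀ a → g a ≡ h a) → anyᶠ m g ≡ anyᶠ m h
anyᶠ-cong zero    g≡h = refl
anyᶠ-cong (suc m) g≡h = cong₂ _∨_ (g≡h Fin.zero) (anyᶠ-cong m (λ a → g≡h (Fin.suc a)))

count-anyᶠ : ∀ {A : Set} m (Q : Fin m → A → Bool) → (∀ x a b → T (Q a x) → T (Q b x) → a ≡ b) → ∀ xs →
  count (λ x → anyᶠ m (λ a → Q a x)) xs ≡ ∑ℕ m (λ a → count (Q a) xs)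
count-anyᶠ zero    Q Q-once xs = count-false xs
count-anyᶠ (suc m) Q Q-once xs = trans
  (count-∨-disjoint (Q Fin.zero) (λ x → anyᶠ m (λ a → Q (Fin.suc a) x)) disjoint xs)
  (cong (count (Q Fin.zero) xs +_) (count-anyᶠ m (λ a → Q (Fin.suc a))
    (λ x a b Qa Qb → Finₚ.suc-injective (Q-once x (Fin.suc a) (Fin.suc b) Qa Qb)) xs))
  where
  disjoint : ∀ x → T (Q Fin.zero x) → T (anyᶠ m (λ a → Q (Fin.suc a) x)) → ⊥
  disjoint x Q₀ any with a , Qa ← anyᶠ-witness m (λ a → Q (Fin.suc a) x) any
                   with () ← Q-once x Fin.zero (Fin.suc a) Q₀ Qa

⌊×-dec⌋ : ∀ {A B : Set} (a? : Dec A) (b? : Dec B) → ⌊ a? ×-dec b? ⌋ ≡ ⌊ a? ⌋ ∧ ⌊ b? ⌋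
⌊×-dec⌋ a? b? = trans (isYes≗does (a? ×-dec b?)) (sym (cong₂ _∧_ (isYes≗does a?) (isYes≗does b?)))

congruent?-crt : ∀ {D E} (v : Vec Bool D) (w : Vec Bool E) (bz : Bezout (monic v) (monic w)) e c
                   {n} (f : Vec Bool n) →
  congruent? (proj₁ (monic-⊗ v w)) (crt-solution bz e c) f ≡ congruent? v e f ∧ congruent? w c f
congruent?-crt v w bz e c f =
  trans (⌊⌋-⇔ (both (toList f)) (rem u (toList f) ≟ᵛ rem u e′) (v? ×-dec w?)) (⌊×-dec⌋ v? w?)
  where
  u = proj₁ (monic-⊗ v w)
  e′ = crt-solution bz e c
  v? = rem v (toList f) ≟ᵛ rem v e
  w? = rem w (toList f) ≟ᵛ rem w c
  both : ∀ g → rem u g ≡ rem u e′ ⇔ (rem v g ≡ rem v e × rem w g ≡ rem w c)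
  both g = ⇔-sym (rem≡⇔∣ᶜ v g e ×-⇔ rem≡⇔∣ᶜ w g c)
       ⇔-∘ (⇔-sym (crt bz e c g) ⇔-∘ (product-is-monic-u ⇔-∘ rem≡⇔∣ᶜ u g e′))
    where
    product-is-monic-u : monic u ∣ᶜ g ⊕ e′ ⇔ monic v ⊗ monic w ∣ᶜ g ⊕ e′
    product-is-monic-u = mk⇔ (∣ᶜ-respˡ (≡⇒≈ᶜ (sym (proj₂ (monic-⊗ v w))))) (∣ᶜ-respˡ (≡⇒≈ᶜ (proj₂ (monic-⊗ v w))))

-- S_i is the union of the classes of residue i a modulo monic (modulus i), a < k i.
record Sieve (t : ℕ) : Set where
  field
    d k               : Fin t → ℕ
    modulus           : (i : Fin t) → Vec Bool (d i)
    residue           : (i : Fin t) → Fin (k i) → Poly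
    residues-distinct : ∀ i a b → rem (modulus i) (residue i a) ≡ rem (modulus i) (residue i b) → a ≡ b
    moduli-coprime    : ∀ i j → i ≢ j → Bezout (monic (modulus i)) (monic (modulus j))
open Sieve

tail : ∀ {t} → Sieve (suc t) → Sieve t
tail σ = record
  { d                 = λ i → d σ (Fin.suc i)
  ; k                 = λ i → k σ (Fin.suc i)
  ; modulus           = λ i → modulus σ (Fin.suc i)
  ; residue           = λ i → residue σ (Fin.suc i)
  ; residues-distinct = λ i → residues-distinct σ (Fin.suc i)
  ; moduli-coprime    = λ i j i≢j → moduli-coprime σ (Fin.suc i) (Fin.suc j) (λ e → i≢j (Finₚ.suc-injective e))
  }

skip⁺ : ∀ {t} → (Fin (suc t) → Bool) → Fin t → Bool
skip⁺ skip i = skip (Fin.suc i)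

opaque
  density : ∀ {t} → Sieve t → (Fin t → Bool) → ℚ
  density {t} σ skip = ∏ t (λ i → if skip i then 1ℚ else 1ℚ ℚ.- k σ i /2^ d σ i)

  error : ∀ {t} → Sieve t → (Fin t → Bool) → ℚ
  error {t} σ skip = ∏ t (λ i → if skip i then 1ℚ else 1ℚ ℚ.+ ℕ→ℚ (k σ i))

opaque
  unfolding density error

  density-unfold : ∀ {t} (σ : Sieve t) skip → density σ skip ≡ ∏ t (λ i → if skip i then 1ℚ else 1ℚ ℚ.- k σ i /2^ d σ i)
  density-unfold σ skip = refl

  error-unfold : ∀ {t} (σ : Sieve t) skip → error σ skip ≡ ∏ t (λ i → if skip i then 1ℚ else 1ℚ ℚ.+ ℕ→ℚ (k σ i))
  error-unfold σ skip = refl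

  density-[] : ∀ (σ : Sieve 0) skip → density σ skip ≡ 1ℚ
  density-[] σ skip = refl

  error-[] : ∀ (σ : Sieve 0) skip → error σ skip ≡ 1ℚ
  error-[] σ skip = refl

  density-skip : ∀ {t} (σ : Sieve (suc t)) skip → skip Fin.zero ≡ true → density σ skip ≡ density (tail σ) (skip⁺ skip)
  density-skip σ skip skip₀ = trans (cong (λ b → (if b then 1ℚ else _) ℚ.* density (tail σ) (skip⁺ skip)) skip₀) (ℚₚ.*-identityˡ _)

  error-skip : ∀ {t} (σ : Sieve (suc t)) skip → skip Fin.zero ≡ true → error σ skip ≡ error (tail σ) (skip⁺ skip)
  error-skip σ skip skip₀ = trans (cong (λ b → (if b then 1ℚ else _) ℚ.* error (tail σ) (skip⁺ skip)) skip₀) (ℚₚ.*-identityˡ _)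

  density-sieve : ∀ {t} (σ : Sieve (suc t)) skip → skip Fin.zero ≡ false →
    density σ skip ≡ (1ℚ ℚ.- ℕ→ℚ (k σ Fin.zero) ℚ.* ½^ d σ Fin.zero) ℚ.* density (tail σ) (skip⁺ skip)
  density-sieve σ skip skip₀ = cong₂ (λ b x → (if b then 1ℚ else 1ℚ ℚ.- x) ℚ.* density (tail σ) (skip⁺ skip))
    skip₀ (/2^-as-* (k σ Fin.zero) (d σ Fin.zero))

  error-sieve : ∀ {t} (σ : Sieve (suc t)) skip → skip Fin.zero ≡ false →
    error σ skip ≡ (1ℚ ℚ.+ ℕ→ℚ (k σ Fin.zero)) ℚ.* error (tail σ) (skip⁺ skip)
  error-sieve σ skip skip₀ = cong (λ b → (if b then 1ℚ else _) ℚ.* error (tail σ) (skip⁺ skip)) skip₀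

if-true : ∀ {A : Set} {b} {x y : A} → b ≡ true → (if b then x else y) ≡ x
if-true refl = refl

if-false : ∀ {A : Set} {b} {x y : A} → b ≡ false → (if b then x else y) ≡ y
if-false refl = refl

near-cong : ∀ {b b′ x x′ y y′} → b ≡ b′ → x ≡ x′ → y ≡ y′ → Near b x y → Near b′ x′ y′
near-cong refl refl refl x-near = x-near

module Sieving (n : ℕ) where

  #_ : (Vec Bool n → Bool) → ℕ
  # P = count P (allVecs n)

  hits : ∀ {t} → Sieve t → Fin t → Vec Bool n → Bool
  hits σ i f = anyᶠ (k σ i) (λ a → congruent? (modulus σ i) (residue σ i a) f)

  avoids : ∀ {t} → Sieve t → (Fin t → Bool) → Vec Bool n → Bool
  avoids {zero}  σ skip f = true
  avoids {suc t} σ skip f = (skip Fin.zero ∨ not (hits σ Fin.zero f)) ∧ avoids (tail σ) (skip⁺ skip) f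

  opaque
    survivors : ∀ {t D} → Sieve t → (Fin t → Bool) → Vec Bool D → Poly → ℕ
    survivors σ skip v e = # λ f → congruent? v e f ∧ avoids σ skip f

  count-hits : ∀ {t} (σ : Sieve t) i (B : Vec Bool n → Bool) →
    # (λ f → hits σ i f ∧ B f) ≡ ∑ℕ (k σ i) (λ a → # (λ f → congruent? (modulus σ i) (residue σ i a) f ∧ B f))
  count-hits σ i B = trans (count-cong commute (allVecs n)) (count-anyᶠ (k σ i) Y∧B once (allVecs n))
    where
    Y∧B : Fin (k σ i) → Vec Bool n → Bool
    Y∧B a f = congruent? (modulus σ i) (residue σ i a) f ∧ B f
    commute : ∀ f → hits σ i f ∧ B f ≡ anyᶠ (k σ i) (λ a → Y∧B a f)
    commute f = trans (𝔹.∧-comm (hits σ i f) (B f))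
      (trans (∧-anyᶠ (k σ i) (B f) _) (anyᶠ-cong (k σ i) λ a → 𝔹.∧-comm (B f) _))
    once : ∀ f a b → T (Y∧B a f) → T (Y∧B b f) → a ≡ b
    once f a b Ya Yb = residues-distinct σ i a b (trans (sym (in-class a Ya)) (in-class b Yb))
      where
      in-class : ∀ a → T (Y∧B a f) → rem (modulus σ i) (toList f) ≡ rem (modulus σ i) (residue σ i a)
      in-class a Ya = toWitness (proj₁ (Equivalence.to (𝔹.T-∧ {congruent? (modulus σ i) (residue σ i a) f}) Ya))

  opaque
    unfolding survivors

    survivors-exact : ∀ {D} (σ : Sieve 0) skip (v : Vec Bool D) e → D ≤ n → survivors σ skip v e ≡ 2 ^ (n ∸ D)
    survivors-exact {D} σ skip v e D≤n = begin
      # (λ f → congruent? v e f ∧ true)  ≡⟨ count-cong (λ f → 𝔹.∧-identityʳ _) (allVecs n) ⟩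
      # (inFibre v (rem v e))            ≡⟨ fibre-size v n D≤n (rem v e) ⟩
      2 ^ (n ∸ D)                        ∎
      where open ≡-Reasoning

    survivors-small : ∀ {D} (σ : Sieve 0) skip (v : Vec Bool D) e → n ≤ D → survivors σ skip v e ≤ 1
    survivors-small σ skip v e n≤D = begin
      # (λ f → congruent? v e f ∧ true)  ≡⟨ count-cong (λ f → 𝔹.∧-identityʳ _) (allVecs n) ⟩
      # (inFibre v (rem v e))            ≤⟨ fibre≤1 v n≤D (rem v e) ⟩
      1                                  ∎
      where open ℕₚ.≤-Reasoning

    survivors-skip : ∀ {t D} (σ : Sieve (suc t)) skip (v : Vec Bool D) e → skip Fin.zero ≡ true →
      survivors σ skip v e ≡ survivors (tail σ) (skip⁺ skip) v e
    survivors-skip σ skip v e skip₀ =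
      cong (λ b → # λ f → congruent? v e f ∧ ((b ∨ not (hits σ Fin.zero f)) ∧ avoids (tail σ) (skip⁺ skip) f)) skip₀

    survivors-unfold : ∀ {t D} (σ : Sieve t) skip (v : Vec Bool D) e →
      survivors σ skip v e ≡ # (λ f → congruent? v e f ∧ avoids σ skip f)
    survivors-unfold σ skip v e = refl

    survivors-all : ∀ {t} (σ : Sieve t) skip → survivors σ skip [] [] ≡ # (avoids σ skip)
    survivors-all σ skip = count-cong (λ f → cong (_∧ avoids σ skip f) (modulo-1 (rem [] (toList f)) (rem [] []))) (allVecs n)
      where
      modulo-1 : (u v : Vec Bool 0) → ⌊ u ≟ᵛ v ⌋ ≡ true
      modulo-1 [] [] = refl

    -- Sieving out S₀ from a residue class removes its intersections with the k₀ classes of S₀,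
    -- which by the Chinese remainder theorem are residue classes modulo the product.
    survivors-split : ∀ {t D} (σ : Sieve (suc t)) skip (v : Vec Bool D) e → skip Fin.zero ≡ false →
      (bz : Bezout (monic v) (monic (modulus σ Fin.zero))) →
      survivors (tail σ) (skip⁺ skip) v e
        ≡ survivors σ skip v e + ∑ℕ (k σ Fin.zero) (λ a → survivors (tail σ) (skip⁺ skip)
                                                      (proj₁ (monic-⊗ v (modulus σ Fin.zero))) (crt-solution bz e (residue σ Fin.zero a)))
    survivors-split σ skip v e skip₀ bz = begin
      # (λ f → C f ∧ A f)
        ≡⟨ count-split (λ f → C f ∧ A f) (hits σ Fin.zero) (allVecs n) ⟩
      # (λ f → (C f ∧ A f) ∧ hits σ Fin.zero f) + # (λ f → (C f ∧ A f) ∧ not (hits σ Fin.zero f))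
        ≡⟨ cong₂ _+_ (trans (count-cong in-S₀ (allVecs n)) (count-hits σ Fin.zero (λ f → C f ∧ A f)))
                     (count-cong sieved (allVecs n)) ⟩
      ∑ℕ k₀ (λ a → # (λ f → congruent? w₀ (residue σ Fin.zero a) f ∧ (C f ∧ A f))) + # (λ f → C f ∧ avoids σ skip f)
        ≡⟨ cong (_+ # (λ f → C f ∧ avoids σ skip f)) (∑ℕ-cong k₀ λ a → count-cong (refined a) (allVecs n)) ⟩
      ∑ℕ k₀ (λ a → # (Q a)) + # (λ f → C f ∧ avoids σ skip f)
        ≡⟨ ℕₚ.+-comm (∑ℕ k₀ (λ a → # (Q a))) _ ⟩
      # (λ f → C f ∧ avoids σ skip f) + ∑ℕ k₀ (λ a → # (Q a)) ∎
      where
      open ≡-Reasoning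
      k₀ : ℕ
      k₀ = k σ Fin.zero
      w₀ : Vec Bool (d σ Fin.zero)
      w₀ = modulus σ Fin.zero
      C A : Vec Bool n → Bool
      C = congruent? v e
      A = avoids (tail σ) (skip⁺ skip)
      Q : Fin k₀ → Vec Bool n → Bool
      Q a f = congruent? (proj₁ (monic-⊗ v w₀)) (crt-solution bz e (residue σ Fin.zero a)) f ∧ A f
      in-S₀ : ∀ f → (C f ∧ A f) ∧ hits σ Fin.zero f ≡ hits σ Fin.zero f ∧ (C f ∧ A f)
      in-S₀ f = 𝔹.∧-comm (C f ∧ A f) _
      refined : ∀ a f → congruent? w₀ (residue σ Fin.zero a) f ∧ (C f ∧ A f) ≡ Q a f
      refined a f = begin
        congruent? w₀ (residue σ Fin.zero a) f ∧ (C f ∧ A f)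
          ≡⟨ solve 3 (λ y c x → y :* (c :* x) := (c :* y) :* x) refl (congruent? w₀ (residue σ Fin.zero a) f) (C f) (A f) ⟩
        (C f ∧ congruent? w₀ (residue σ Fin.zero a) f) ∧ A f
          ≡⟨ cong (_∧ A f) (sym (congruent?-crt v w₀ bz e (residue σ Fin.zero a) f)) ⟩
        Q a f ∎
        where open ∨-∧-Solver
      sieved : ∀ f → (C f ∧ A f) ∧ not (hits σ Fin.zero f) ≡ C f ∧ avoids σ skip f
      sieved f = trans (trans (𝔹.∧-assoc (C f) (A f) _) (cong (C f ∧_) (𝔹.∧-comm (A f) _)))
        (cong (λ b → C f ∧ ((b ∨ not (hits σ Fin.zero f)) ∧ A f)) (sym skip₀))

  classCount : ∀ {t D} → Sieve t → (Fin t → Bool) → Vec Bool D → Poly → ℚ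
  classCount σ skip v e = ℕ→ℚ (survivors σ skip v e)

  classCount-base : ∀ {D} (σ : Sieve 0) skip (v : Vec Bool D) e →
    Near 1ℚ (classCount σ skip v e) (ℕ→ℚ (2 ^ n) ℚ.* ½^ D ℚ.* 1ℚ)
  classCount-base {D} σ skip v e with D ℕₚ.≤? n
  ... | yes D≤n = near-exact (trans (cong ℕ→ℚ (survivors-exact σ skip v e D≤n)) (sym (2^*½^ n D D≤n)))
  ... | no D≰n = near-small (2^*½^-pos n D) (2^*½^<1 n D n<D) (ℕ→ℚ-nonNeg (survivors σ skip v e))
                   (ℕ→ℚ-mono-≤ (survivors-small σ skip v e (ℕₚ.<⇒≤ n<D)))
    where
    n<D : n < D
    n<D = ℕₚ.≰⇒> D≰n

  classCount-split : ∀ {t D} (σ : Sieve (suc t)) skip (v : Vec Bool D) e → skip Fin.zero ≡ false →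
    (bz : Bezout (monic v) (monic (modulus σ Fin.zero))) →
    classCount (tail σ) (skip⁺ skip) v e
      ≡ classCount σ skip v e ℚ.+ ∑ (k σ Fin.zero) (λ a → classCount (tail σ) (skip⁺ skip)
                                                    (proj₁ (monic-⊗ v (modulus σ Fin.zero))) (crt-solution bz e (residue σ Fin.zero a)))
  classCount-split σ skip v e skip₀ bz = begin
    ℕ→ℚ (survivors (tail σ) (skip⁺ skip) v e)
      ≡⟨ cong ℕ→ℚ (survivors-split σ skip v e skip₀ bz) ⟩
    ℕ→ℚ (survivors σ skip v e + ∑ℕ (k σ Fin.zero) Y)
      ≡⟨ ℕ→ℚ-+ (survivors σ skip v e) (∑ℕ (k σ Fin.zero) Y) ⟩
    ℕ→ℚ (survivors σ skip v e) ℚ.+ ℕ→ℚ (∑ℕ (k σ Fin.zero) Y)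
      ≡⟨ cong (ℕ→ℚ (survivors σ skip v e) ℚ.+_) (ℕ→ℚ-∑ℕ (k σ Fin.zero) Y) ⟩
    ℕ→ℚ (survivors σ skip v e) ℚ.+ ∑ (k σ Fin.zero) (λ a → ℕ→ℚ (Y a)) ∎
    where
    open ≡-Reasoning
    Y : Fin (k σ Fin.zero) → ℕ
    Y a = survivors (tail σ) (skip⁺ skip) (proj₁ (monic-⊗ v (modulus σ Fin.zero))) (crt-solution bz e (residue σ Fin.zero a))

  classCount-near : ∀ {t D} (σ : Sieve t) skip (v : Vec Bool D) e →
    (∀ i → skip i ≡ false → Bezout (monic v) (monic (modulus σ i))) →
    Near (error σ skip) (classCount σ skip v e) (ℕ→ℚ (2 ^ n) ℚ.* ½^ D ℚ.* density σ skip)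
  classCount-near {zero} {D} σ skip v e _ =
    near-cong (sym (error-[] σ skip)) refl (cong (ℕ→ℚ (2 ^ n) ℚ.* ½^ D ℚ.*_) (sym (density-[] σ skip))) (classCount-base σ skip v e)
  classCount-near {suc t} {D} σ skip v e bz = by-cases (skip Fin.zero) refl
    where
    M : ℚ
    M = ℕ→ℚ (2 ^ n) ℚ.* ½^ D
    rest : Near (error (tail σ) (skip⁺ skip)) (classCount (tail σ) (skip⁺ skip) v e) (M ℚ.* density (tail σ) (skip⁺ skip))
    rest = classCount-near (tail σ) (skip⁺ skip) v e (λ i → bz (Fin.suc i))
    u : Vec Bool (D + d σ Fin.zero)
    u = proj₁ (monic-⊗ v (modulus σ Fin.zero))
    u-coprime : ∀ i → skip⁺ skip i ≡ false → Bezout (monic u) (monic (modulus σ (Fin.suc i)))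
    u-coprime i skipᵢ = Bezout-respˡ (≡⇒≈ᶜ (proj₂ (monic-⊗ v (modulus σ Fin.zero))))
      (Bezout-⊗ˡ (bz (Fin.suc i) skipᵢ) (moduli-coprime σ Fin.zero (Fin.suc i) λ ()))
    by-cases : ∀ b → skip Fin.zero ≡ b →
      Near (error σ skip) (classCount σ skip v e) (M ℚ.* density σ skip)
    by-cases true skip₀ = near-cong (sym (error-skip σ skip skip₀)) (cong ℕ→ℚ (sym (survivors-skip σ skip v e skip₀)))
      (cong (M ℚ.*_) (sym (density-skip σ skip skip₀))) rest
    by-cases false skip₀ =
      near-cong (sym (error-sieve σ skip skip₀)) refl (cong (M ℚ.*_) (sym (density-sieve σ skip skip₀)))
        (near-step (k σ Fin.zero) {B = error (tail σ) (skip⁺ skip)} {M} {½^ d σ Fin.zero} {density (tail σ) (skip⁺ skip)}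
          Y (classCount-split σ skip v e skip₀ bz₀) rest Y-near)
      where
      bz₀ : Bezout (monic v) (monic (modulus σ Fin.zero))
      bz₀ = bz Fin.zero skip₀
      Y : Fin (k σ Fin.zero) → ℚ
      Y a = classCount (tail σ) (skip⁺ skip) u (crt-solution bz₀ e (residue σ Fin.zero a))
      Y-near : ∀ a → Near (error (tail σ) (skip⁺ skip)) (Y a) (M ℚ.* ½^ d σ Fin.zero ℚ.* density (tail σ) (skip⁺ skip))
      Y-near a = near-cong refl refl
        (cong (ℚ._* density (tail σ) (skip⁺ skip)) (trans (cong (ℕ→ℚ (2 ^ n) ℚ.*_) (½^-+ D (d σ Fin.zero)))
                                                          (sym (ℚₚ.*-assoc (ℕ→ℚ (2 ^ n)) (½^ D) (½^ d σ Fin.zero)))))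
        (classCount-near (tail σ) (skip⁺ skip) u (crt-solution bz₀ e (residue σ Fin.zero a)) u-coprime)

  Bezout-1ₚ : ∀ b → Bezout 1ₚ b
  Bezout-1ₚ b = 1ₚ , [] , ⊗-identityˡ 1ₚ

  -- The induction of classCount-near for the modulus 1, whose exact base case yields the extra 1.
  avoiders-lower : ∀ {t} (σ : Sieve t) skip →
    ℕ→ℚ (2 ^ n) ℚ.* density σ skip ℚ.- error σ skip ℚ.+ 1ℚ ℚ.≤ classCount σ skip [] []
  avoiders-lower {zero} σ skip = ℚₚ.≤-reflexive (begin
    N ℚ.* density σ skip ℚ.- error σ skip ℚ.+ 1ℚ  ≡⟨ cong₂ (λ P B → N ℚ.* P ℚ.- B ℚ.+ 1ℚ) (density-[] σ skip) (error-[] σ skip) ⟩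
    N ℚ.* 1ℚ ℚ.- 1ℚ ℚ.+ 1ℚ                        ≡⟨ solve 1 (λ N → N :* con 1ℚ :- con 1ℚ :+ con 1ℚ := N) refl N ⟩
    N                                             ≡⟨ sym (cong ℕ→ℚ (survivors-exact σ skip [] [] z≤n)) ⟩
    classCount σ skip [] []                       ∎)
    where
    open ≡-Reasoning
    open ℚ-Solver
    N : ℚ
    N = ℕ→ℚ (2 ^ n)
  avoiders-lower {suc t} σ skip = by-cases (skip Fin.zero) refl
    where
    N : ℚ
    N = ℕ→ℚ (2 ^ n)
    rest : N ℚ.* density (tail σ) (skip⁺ skip) ℚ.- error (tail σ) (skip⁺ skip) ℚ.+ 1ℚ ℚ.≤ classCount (tail σ) (skip⁺ skip) [] []
    rest = avoiders-lower (tail σ) (skip⁺ skip)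
    by-cases : ∀ b → skip Fin.zero ≡ b → N ℚ.* density σ skip ℚ.- error σ skip ℚ.+ 1ℚ ℚ.≤ classCount σ skip [] []
    by-cases true skip₀ = subst₂ ℚ._≤_
      (cong₂ (λ P B → N ℚ.* P ℚ.- B ℚ.+ 1ℚ) (sym (density-skip σ skip skip₀)) (sym (error-skip σ skip skip₀)))
      (cong ℕ→ℚ (sym (survivors-skip σ skip [] [] skip₀))) rest
    by-cases false skip₀ = subst₂ ℚ._≤_
      (cong₂ (λ P B → N ℚ.* P ℚ.- B ℚ.+ 1ℚ) (sym (density-sieve σ skip skip₀)) (sym (error-sieve σ skip skip₀))) refl
      (lower-step (k σ Fin.zero) {error (tail σ) (skip⁺ skip)} {N} {½^ d σ Fin.zero} {density (tail σ) (skip⁺ skip)}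
        Y (classCount-split σ skip [] [] skip₀ bz₀) rest (λ a → upper (Y-near a)))
      where
      bz₀ : Bezout (monic []) (monic (modulus σ Fin.zero))
      bz₀ = Bezout-1ₚ _
      Y : Fin (k σ Fin.zero) → ℚ
      Y a = classCount (tail σ) (skip⁺ skip) (modulus σ Fin.zero) (crt-solution bz₀ [] (residue σ Fin.zero a))
      Y-near : ∀ a → Near (error (tail σ) (skip⁺ skip)) (Y a) (N ℚ.* ½^ d σ Fin.zero ℚ.* density (tail σ) (skip⁺ skip))
      Y-near a = classCount-near (tail σ) (skip⁺ skip) (modulus σ Fin.zero) _
        (λ i _ → moduli-coprime σ Fin.zero (Fin.suc i) λ ())

  avoids-∧-complement : ∀ {t} (σ : Sieve t) (skip : Fin t → Bool) f →
    avoids σ skip f ∧ avoids σ (λ i → not (skip i)) f ≡ avoids σ (λ _ → false) f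
  avoids-∧-complement {zero}  σ skip f = refl
  avoids-∧-complement {suc t} σ skip f = trans (combine (skip Fin.zero) (not (hits σ Fin.zero f)) _ _)
    (cong (not (hits σ Fin.zero f) ∧_) (avoids-∧-complement (tail σ) (skip⁺ skip) f))
    where
    open ∨-∧-Solver
    combine : ∀ s y a b → ((s ∨ y) ∧ a) ∧ ((not s ∨ y) ∧ b) ≡ y ∧ (a ∧ b)
    combine true  y a b = solve 3 (λ y a b → a :* (y :* b) := y :* (a :* b)) refl y a b
    combine false y a b = solve 3 (λ y a b → (y :* a) :* b := y :* (a :* b)) refl y a b

  union-bound : ∀ {t} (σ : Sieve t) (skip : Fin t → Bool) (A : Vec Bool n → Bool) →
    # A ≤ # (λ f → A f ∧ avoids σ (λ i → not (skip i)) f) + ∑ℕ t (λ i → if skip i then # (λ f → hits σ i f ∧ A f) else 0)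
  union-bound {zero}  σ skip A =
    ℕₚ.≤-reflexive (trans (count-cong (λ f → sym (𝔹.∧-identityʳ (A f))) (allVecs n)) (sym (ℕₚ.+-identityʳ _)))
  union-bound {suc t} σ skip A = begin
    # A                                                     ≤⟨ union-bound (tail σ) (skip⁺ skip) A ⟩
    # (λ f → A f ∧ avT f) + Σ′                              ≡⟨ cong (_+ Σ′) (count-split (λ f → A f ∧ avT f) X (allVecs n)) ⟩
    (# (λ f → (A f ∧ avT f) ∧ X f) + # (λ f → (A f ∧ avT f) ∧ not (X f))) + Σ′
      ≤⟨ ℕₚ.+-monoˡ-≤ Σ′ (ℕₚ.+-mono-≤ (ℕₚ.≤-reflexive (count-cong survives (allVecs n))) (in-S₀ (skip Fin.zero) refl)) ⟩
    (# (λ f → A f ∧ avoids σ skip″ f) + T₀) + Σ′            ≡⟨ ℕₚ.+-assoc (# (λ f → A f ∧ avoids σ skip″ f)) T₀ Σ′ ⟩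
    # (λ f → A f ∧ avoids σ skip″ f) + (T₀ + Σ′)            ∎
    where
    open ℕₚ.≤-Reasoning
    skip″ : Fin (suc t) → Bool
    skip″ i = not (skip i)
    avT X : Vec Bool n → Bool
    avT = avoids (tail σ) (λ i → not (skip⁺ skip i))
    X f = not (skip Fin.zero) ∨ not (hits σ Fin.zero f)
    T₀ Σ′ : ℕ
    T₀ = if skip Fin.zero then # (λ f → hits σ Fin.zero f ∧ A f) else 0
    Σ′ = ∑ℕ t (λ i → if skip⁺ skip i then # (λ f → hits σ (Fin.suc i) f ∧ A f) else 0)
    survives : ∀ f → (A f ∧ avT f) ∧ X f ≡ A f ∧ avoids σ skip″ f
    survives f = solve 3 (λ a b x → (a :* b) :* x := a :* (x :* b)) refl (A f) (avT f) (X f)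
      where open ∨-∧-Solver
    in-S₀ : ∀ b → skip Fin.zero ≡ b → # (λ f → (A f ∧ avT f) ∧ not (X f)) ≤ T₀
    in-S₀ true skip₀ = subst (λ b → # (λ f → (A f ∧ avT f) ∧ not (not b ∨ not (hits σ Fin.zero f))) ≤
                                    (if b then # (λ f → hits σ Fin.zero f ∧ A f) else 0)) (sym skip₀)
      (count-mono (λ f → hit f (A f) (avT f) (hits σ Fin.zero f)) (allVecs n))
      where
      hit : ∀ f a b h → T ((a ∧ b) ∧ not (not h)) → T (h ∧ a)
      hit f true true true _ = _
    in-S₀ false skip₀ = subst (λ b → # (λ f → (A f ∧ avT f) ∧ not (not b ∨ not (hits σ Fin.zero f))) ≤
                                     (if b then # (λ f → hits σ Fin.zero f ∧ A f) else 0)) (sym skip₀)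
      (ℕₚ.≤-reflexive (count-none _ {allVecs n} (All.tabulate λ {f} _ → no-hit (A f ∧ avT f))))
      where
      no-hit : ∀ a → ¬ T (a ∧ false)
      no-hit true ()

  avoids-none : ∀ {t} (σ : Sieve t) f → T (avoids σ (λ _ → false) f) → ∀ i → ¬ T (hits σ i f)
  avoids-none {suc t} σ f T-avoids Fin.zero    hit with hits σ Fin.zero f
  ... | true = T-avoids
  avoids-none {suc t} σ f T-avoids (Fin.suc i) hit with hits σ Fin.zero f
  ... | false = avoids-none (tail σ) f T-avoids i hit

  hits-bound : ∀ {t} (σ : Sieve t) skip i → skip i ≡ true → 1 ≤ k σ i →
    ℕ→ℚ (# (λ f → hits σ i f ∧ avoids σ skip f))
      ℚ.< ℕ→ℚ (k σ i) ℚ.* (ℕ→ℚ (2 ^ n) ℚ.* ½^ d σ i ℚ.* density σ skip ℚ.+ error σ skip)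
  hits-bound σ skip i skipᵢ kᵢ≥1 = begin-strict
    ℕ→ℚ (# (λ f → hits σ i f ∧ avoids σ skip f))
      ≡⟨ cong ℕ→ℚ (trans (count-hits σ i (avoids σ skip))
                         (∑ℕ-cong (k σ i) λ a → sym (survivors-unfold σ skip (modulus σ i) (residue σ i a)))) ⟩
    ℕ→ℚ (∑ℕ (k σ i) (λ a → survivors σ skip (modulus σ i) (residue σ i a)))
      ≡⟨ ℕ→ℚ-∑ℕ (k σ i) _ ⟩
    ∑ (k σ i) (λ a → classCount σ skip (modulus σ i) (residue σ i a))
      <⟨ ∑-mono-< (k σ i) (Fin.fromℕ< kᵢ≥1) (upper (Y-near _)) (λ a → ℚₚ.<⇒≤ (upper (Y-near a))) ⟩
    ∑ (k σ i) (λ _ → ℕ→ℚ (2 ^ n) ℚ.* ½^ d σ i ℚ.* density σ skip ℚ.+ error σ skip)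
      ≡⟨ ∑-const (k σ i) _ ⟩
    ℕ→ℚ (k σ i) ℚ.* (ℕ→ℚ (2 ^ n) ℚ.* ½^ d σ i ℚ.* density σ skip ℚ.+ error σ skip) ∎
    where
    open ℚₚ.≤-Reasoning
    Y-near : ∀ a → Near (error σ skip) (classCount σ skip (modulus σ i) (residue σ i a)) (ℕ→ℚ (2 ^ n) ℚ.* ½^ d σ i ℚ.* density σ skip)
    Y-near a = classCount-near σ skip (modulus σ i) (residue σ i a) λ j skipⱼ →
      moduli-coprime σ i j λ i≡j → case trans (sym skipᵢ) (trans (cong skip i≡j) skipⱼ) of λ ()

  sieve-bound : ∀ {t} (σ : Sieve t) (skip : Fin t → Bool) → (∀ i → 1 ≤ k σ i) → ∀ i₀ → skip i₀ ≡ true →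
    1ℚ ℚ.+ ℕ→ℚ (2 ^ n) ℚ.* (1ℚ ℚ.- ∑ t (λ i → if skip i then k σ i /2^ d σ i else 0ℚ)) ℚ.* density σ skip
      ℚ.- (1ℚ ℚ.+ ∑ t (λ i → if skip i then ℕ→ℚ (k σ i) else 0ℚ)) ℚ.* error σ skip
    ℚ.< ℕ→ℚ (# (avoids σ (λ _ → false)))
  sieve-bound {t} σ skip k≥1 i₀ skip₀ = begin-strict
    1ℚ ℚ.+ N ℚ.* (1ℚ ℚ.- S₁) ℚ.* P ℚ.- (1ℚ ℚ.+ S₂) ℚ.* B
      ≡⟨ solve 5 (λ N S₁ P S₂ B → con 1ℚ :+ N :* (con 1ℚ :- S₁) :* P :- (con 1ℚ :+ S₂) :* B
                                 := (N :* P :- B :+ con 1ℚ) :- ((N :* P) :* S₁ :+ B :* S₂)) refl N S₁ P S₂ B ⟩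
    (N ℚ.* P ℚ.- B ℚ.+ 1ℚ) ℚ.- ((N ℚ.* P) ℚ.* S₁ ℚ.+ B ℚ.* S₂)
      ≡⟨ cong (λ x → (N ℚ.* P ℚ.- B ℚ.+ 1ℚ) ℚ.- x) (sym ∑G) ⟩
    (N ℚ.* P ℚ.- B ℚ.+ 1ℚ) ℚ.- ∑ t G
      <⟨ ℚₚ.+-monoˡ-< (ℚ.- ∑ t G) (ℚₚ.≤-<-trans (ℚₚ.≤-trans lower-A union) (ℚₚ.+-monoʳ-< none G′<G)) ⟩
    (none ℚ.+ ∑ t G) ℚ.- ∑ t G
      ≡⟨ solve 2 (λ x y → (x :+ y) :- y := x) refl none (∑ t G) ⟩
    none ∎
    where
    open ℚₚ.≤-Reasoning
    open ℚ-Solver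
    N P B S₁ S₂ none : ℚ
    N = ℕ→ℚ (2 ^ n)
    P = density σ skip
    B = error σ skip
    S₁ = ∑ t (λ i → if skip i then k σ i /2^ d σ i else 0ℚ)
    S₂ = ∑ t (λ i → if skip i then ℕ→ℚ (k σ i) else 0ℚ)
    none = ℕ→ℚ (# (avoids σ (λ _ → false)))
    A : Vec Bool n → Bool
    A = avoids σ skip
    G G′ : Fin t → ℚ
    G i = if skip i then ℕ→ℚ (k σ i) ℚ.* (N ℚ.* ½^ d σ i ℚ.* P ℚ.+ B) else 0ℚ
    G′ i = if skip i then ℕ→ℚ (# (λ f → hits σ i f ∧ A f)) else 0ℚ
    lower-A : N ℚ.* P ℚ.- B ℚ.+ 1ℚ ℚ.≤ ℕ→ℚ (# A)
    lower-A = ℚₚ.≤-trans (avoiders-lower σ skip) (ℚₚ.≤-reflexive (cong ℕ→ℚ (survivors-all σ skip)))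
    union : ℕ→ℚ (# A) ℚ.≤ none ℚ.+ ∑ t G′
    union = ℚₚ.≤-trans (ℕ→ℚ-mono-≤ (union-bound σ skip A)) (ℚₚ.≤-reflexive (begin-equality
      ℕ→ℚ (# (λ f → A f ∧ avoids σ (λ i → not (skip i)) f) + ∑ℕ t H)
        ≡⟨ ℕ→ℚ-+ (# (λ f → A f ∧ avoids σ (λ i → not (skip i)) f)) (∑ℕ t H) ⟩
      ℕ→ℚ (# (λ f → A f ∧ avoids σ (λ i → not (skip i)) f)) ℚ.+ ℕ→ℚ (∑ℕ t H)
        ≡⟨ cong₂ ℚ._+_ (cong ℕ→ℚ (count-cong (avoids-∧-complement σ skip) (allVecs n)))
                       (trans (ℕ→ℚ-∑ℕ t H) (∑-cong t λ i → 𝔹.if-float ℕ→ℚ (skip i))) ⟩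
      none ℚ.+ ∑ t G′ ∎))
      where
      H : Fin t → ℕ
      H i = if skip i then # (λ f → hits σ i f ∧ A f) else 0
    G′≤G : ∀ i → G′ i ℚ.≤ G i
    G′≤G i = by-cases (skip i) refl
      where
      by-cases : ∀ b → skip i ≡ b → G′ i ℚ.≤ G i
      by-cases true  skipᵢ = subst₂ ℚ._≤_ (sym (if-true skipᵢ)) (sym (if-true skipᵢ)) (ℚₚ.<⇒≤ (hits-bound σ skip i skipᵢ (k≥1 i)))
      by-cases false skipᵢ = subst₂ ℚ._≤_ (sym (if-false skipᵢ)) (sym (if-false skipᵢ)) (ℚₚ.≤-refl {0ℚ})
    G′<G : ∑ t G′ ℚ.< ∑ t G
    G′<G = ∑-mono-< t i₀ (subst₂ ℚ._<_ (sym (if-true skip₀)) (sym (if-true skip₀)) (hits-bound σ skip i₀ skip₀ (k≥1 i₀))) G′≤G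
    G-split : ∀ i → G i ≡ (N ℚ.* P) ℚ.* (if skip i then k σ i /2^ d σ i else 0ℚ)
                            ℚ.+ B ℚ.* (if skip i then ℕ→ℚ (k σ i) else 0ℚ)
    G-split i with skip i
    ... | true  = trans (solve 5 (λ K N h P B → K :* (N :* h :* P :+ B) := (N :* P) :* (K :* h) :+ B :* K)
                               refl (ℕ→ℚ (k σ i)) N (½^ d σ i) P B)
                        (cong (λ x → (N ℚ.* P) ℚ.* x ℚ.+ B ℚ.* ℕ→ℚ (k σ i)) (sym (/2^-as-* (k σ i) (d σ i))))
    ... | false = solve 2 (λ NP B → con 0ℚ := NP :* con 0ℚ :+ B :* con 0ℚ) refl (N ℚ.* P) B
    ∑G : ∑ t G ≡ (N ℚ.* P) ℚ.* S₁ ℚ.+ B ℚ.* S₂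
    ∑G = trans (∑-cong t G-split) (trans (∑-+ t _ _) (cong₂ ℚ._+_ (∑-*ˡ t (N ℚ.* P) _) (∑-*ˡ t B _)))

lemma2 : (t : ℕ) → 1 ≤ t →
  (p : Fin t → Poly) → (∀ i → ¬ IsZero (p i)) →
  (∀ i j → i ≢ j → Coprime (p i) (p j)) →
  (d : Fin t → ℕ) → (∀ i → deg (p i) ≡ d i) →
  (k : Fin t → ℕ) → (∀ i → 1 ≤ k i) →
  (S : Fin t → Poly → Set) →
  (∀ i → Σ (Fin (k i) → Poly) λ r →
     (∀ a b → a ≢ b → ¬ Congruent (p i) (r a) (r b)) ×
     (∀ f → S i f ⇔ (∃ λ a → Congruent (p i) f (r a)))) →
  (n : ℕ) → 1 ≤ n →
  (L : List (Vec Bool n)) → Unique L →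
  (∀ f → (f ∈ L) ⇔ (∀ i → ¬ S i (toList f))) →
  (s : ℕ) → 1 ≤ s → s ≤ t →
  (1ℚ ℚ.+ ℕ→ℚ (2 ^ n) ℚ.* (1ℚ ℚ.- ∑≤ t s (λ i → k i /2^ d i))
        ℚ.* ∏> t s (λ i → 1ℚ ℚ.- k i /2^ d i)
   ℚ.- (1ℚ ℚ.+ ∑≤ t s (λ i → ℕ→ℚ (k i))) ℚ.* ∏> t s (λ i → 1ℚ ℚ.+ ℕ→ℚ (k i)))
  ℚ.< ℕ→ℚ (length L)
lemma2 (suc t) _ p p≢0 coprime d deg≡d k k≥1 S S-classes n _ L _ L-survivors (suc s) _ _ =
  ℚₚ.<-≤-trans
    (subst₂ (λ P B → 1ℚ ℚ.+ ℕ→ℚ (2 ^ n) ℚ.* (1ℚ ℚ.- ∑≤ (suc t) (suc s) (λ i → k i /2^ d i)) ℚ.* P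
                      ℚ.- (1ℚ ℚ.+ ∑≤ (suc t) (suc s) (λ i → ℕ→ℚ (k i))) ℚ.* B ℚ.< ℕ→ℚ (# (avoids σ (λ _ → false))))
      (density-unfold σ skip) (error-unfold σ skip) (sieve-bound σ skip k≥1 Fin.zero refl))
    (ℕ→ℚ-mono-≤ (count-≤-length _≟ᵛ_ (avoids σ (λ _ → false)) (allVecs-unique n) L survivor∈L))
  where
  open Sieving n
  skip : Fin (suc t) → Bool
  skip i = Fin.toℕ i ℕ.<ᵇ suc s
  monic-p : ∀ i → Σ (Vec Bool (d i)) λ w → p i ≈ᶜ monic w
  monic-p i = nonzero⇒monic (p i) (p≢0 i) (deg≡d i)
  w : (i : Fin (suc t)) → Vec Bool (d i)
  w i = proj₁ (monic-p i)
  p≈w : ∀ i → p i ≈ᶜ monic (w i)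
  p≈w i = proj₂ (monic-p i)
  r : (i : Fin (suc t)) → Fin (k i) → Poly
  r i = proj₁ (S-classes i)
  rem≡⇔Congruent : ∀ i f g → rem (w i) f ≡ rem (w i) g ⇔ Congruent (p i) f g
  rem≡⇔Congruent i f g = mk⇔ (λ e → ∣ᶜ⇒∣ (∣ᶜ-respˡ (≈ᶜ-sym (p≈w i)) (Equivalence.to (rem≡⇔∣ᶜ (w i) f g) e)))
                             (λ c → Equivalence.from (rem≡⇔∣ᶜ (w i) f g) (∣ᶜ-respˡ (p≈w i) (∣⇒∣ᶜ c)))
  σ : Sieve (suc t)
  σ = record
    { d = d ; k = k ; modulus = w ; residue = r
    ; residues-distinct = λ i a b e → decidable-stable (a Finₚ.≟ b) λ a≢b →
        proj₁ (proj₂ (S-classes i)) a b a≢b (Equivalence.to (rem≡⇔Congruent i (r i a) (r i b)) e)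
    ; moduli-coprime = λ i j i≢j → coprime⇒Bezout (p i) (p j) (w i) (w j) (p≈w i) (p≈w j) (coprime i j i≢j)
    }
  survivor∈L : ∀ f → T (avoids σ (λ _ → false) f) → f ∈ L
  survivor∈L f survives = Equivalence.from (L-survivors f) λ i f∈Sᵢ →
    let a , f≡rₐ = Equivalence.to (proj₂ (proj₂ (S-classes i)) (toList f)) f∈Sᵢ in
    avoids-none σ f survives i (anyᶠ-intro (k i) _ a (fromWitness (Equivalence.from (rem≡⇔Congruent i (toList f) (r i a)) f≡rₐ)))
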